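{- Let $n\ge2$. Let $\mathcal{H}(n)$ be the group with generators $x_1,\dots,x_n,y_1,\dots,y_n$ and defining relations, for all $x,x'\in X_0=\{x_1,\dots,x_n\}$, $y,y'\in Y_0=\{y_1,\dots,y_n\}$, $z,z',z'',z'''\in X_0\cup Y_0$: $z^2=1$, $[x,x']=[y,y']=1$, $[x,y]^2=1$, $[[y,x],y']=1$, $[[x,y],z]^2=1$, $[[[z,z'],z''],z''']=1$. Let $F$ be the free group on $A=\{a_1,\dots,a_{2n}\}$ with lower central series $F_1=F$, $F_{k+1}=[F_k,F]$, let $A_0=\{a_1,\dots,a_n\}$, $B_0=\{a_{n+1},\dots,a_{2n}\}$, \[ K=\langle F_4,\ a_i^2,\ [a_i,a_j]^2,\ [[a_i,a_j],a_k]^2,\ [[a_i,a_j],a_i] : i,j,k\in\{1,\dots,2n\}\rangle, \] \[ I=\langle K,\ [a,a'],\ [b,b'],\ [[a,a'],c],\ [[b,b'],c],\ [[b,a],b'] : a,a'\in A_0,\ b,b'\in B_0,\ c\in A\rangle, \] a normal subgroup of $F$. Then the assignment $a_iI\mapsto x_i$, $a_{n+i}I\mapsto y_i$ ($1\le i\le n$) defines an epimorphism $\psi:F/I\to\mathcal{H}(n)$ which is the inverse of the epimorphism $\phi:\mathcal{H}(n)\to F/I$ given by $x_i\mapsto a_iI$, $y_i\mapsto a_{n+i}I$. In particular $\mathcal{H}(n)\cong F/I$ and $|\mathcal{H}(n)|=2^{(n^3+n^2+4n)/2}$.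
   Context: Commutators: $[a,b]=a^{ -1}b^{ -1}ab$. -}

module Defs where

open import Data.Nat using (ℕ; zero; suc; _+_; _*_; _^_; _/_)
open import Data.Bool using (Bool; true; false; not)
open import Data.Product using (_×_; _,_; ∃)
open import Data.Sum using (_⊎_; inj₁; inj₂)
open import Data.List using (List; []; _∷_; _++_; reverse; map; [_])
open import Data.Fin using (Fin; _↑ˡ_; _↑ʳ_; splitAt; join)
open import Relation.Binary.PropositionalEquality using (_≡_)

-- Words in a free group on a generating type G.
-- A letter (g , true) is g, a letter (g , false) is g⁻¹.

Letter : Set → Set
Letter G = G × Bool

Word : Set → Set
Word G = List (Letter G)

flipL : {G : Set} → Letter G → Letter G
flipL (g , b) = g , not b

invW : {G : Set} → Word G → Word G
invW w = reverse (map flipL w)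

gen : {G : Set} → G → Word G
gen g = [ g , true ]

comm : {G : Set} → Word G → Word G → Word G
comm u v = invW u ++ invW v ++ u ++ v

sq : {G : Set} → Word G → Word G
sq w = w ++ w

-- Two words are related iff they represent the same element of
-- F(G) / ⟨⟨R⟩⟩.

data Eqv {G : Set} (R : Word G → Set) : Word G → Word G → Set where
  eqv-refl   : ∀ {u} → Eqv R u u
  eqv-sym    : ∀ {u v} → Eqv R u v → Eqv R v u
  eqv-trans  : ∀ {u v w} → Eqv R u v → Eqv R v w → Eqv R u w
  eqv-cancel : ∀ u v l → Eqv R (u ++ l ∷ flipL l ∷ v) (u ++ v)
  eqv-rel    : ∀ u v r → R r → Eqv R (u ++ r ++ v) (u ++ v)

mapW : {G H : Set} → (G → H) → Word G → Word H
mapW f = map (λ { (g , b) → f g , b })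

RespectsRel : {G H : Set} → (Word G → Set) → (Word H → Set) → (G → H) → Set
RespectsRel R S f = ∀ u v → Eqv R u v → Eqv S (mapW f u) (mapW f v)

HasOrder : {G : Set} → (Word G → Set) → ℕ → Set
HasOrder {G} R N =
  ∃ λ (e : Fin N → Word G) →
    (∀ i j → Eqv R (e i) (e j) → i ≡ j) × (∀ w → ∃ λ i → Eqv R w (e i))

data LCS {G : Set} : ℕ → Word G → Set where
  lcs-all  : ∀ w → LCS 1 w
  lcs-comm : ∀ {k u} → LCS (suc k) u → ∀ v → LCS (suc (suc k)) (comm u v)
  lcs-one  : ∀ {k} → LCS (suc (suc k)) []
  lcs-mul  : ∀ {k u v} → LCS (suc (suc k)) u → LCS (suc (suc k)) v →
             LCS (suc (suc k)) (u ++ v)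
  lcs-inv  : ∀ {k u} → LCS (suc (suc k)) u → LCS (suc (suc k)) (invW u)

XY : ℕ → Set
XY n = Fin n ⊎ Fin n

x y : (n : ℕ) → Fin n → Word (XY n)
x n i = gen (inj₁ i)
y n i = gen (inj₂ i)

data HRel (n : ℕ) : Word (XY n) → Set where
  h-sq    : ∀ z → HRel n (sq (gen z))
  h-xx    : ∀ i j → HRel n (comm (x n i) (x n j))
  h-yy    : ∀ i j → HRel n (comm (y n i) (y n j))
  h-xy²   : ∀ i j → HRel n (sq (comm (x n i) (y n j)))
  h-yxy   : ∀ i j k → HRel n (comm (comm (y n i) (x n j)) (y n k))
  h-xyz²  : ∀ i j z → HRel n (sq (comm (comm (x n i) (y n j)) (gen z)))
  h-zzzz  : ∀ z z' z'' z''' →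
            HRel n (comm (comm (comm (gen z) (gen z')) (gen z'')) (gen z'''))

a b : (n : ℕ) → Fin n → Word (Fin (n + n))
a n i = gen (i ↑ˡ n)
b n i = gen (n ↑ʳ i)

data KRel (n : ℕ) : Word (Fin (n + n)) → Set where
  k-F4   : ∀ {w} → LCS 4 w → KRel n w
  k-sq   : ∀ i → KRel n (sq (gen i))
  k-c²   : ∀ i j → KRel n (sq (comm (gen i) (gen j)))
  k-cc²  : ∀ i j k → KRel n (sq (comm (comm (gen i) (gen j)) (gen k)))
  k-cci  : ∀ i j → KRel n (comm (comm (gen i) (gen j)) (gen i))

-- generators of I (I taken as the normal closure in F; the paper
-- asserts I is normal)
data IRel (n : ℕ) : Word (Fin (n + n)) → Set where
  i-K    : ∀ {w} → KRel n w → IRel n w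
  i-aa   : ∀ i j → IRel n (comm (a n i) (a n j))
  i-bb   : ∀ i j → IRel n (comm (b n i) (b n j))
  i-aac  : ∀ i j c → IRel n (comm (comm (a n i) (a n j)) (gen c))
  i-bbc  : ∀ i j c → IRel n (comm (comm (b n i) (b n j)) (gen c))
  i-bab  : ∀ i j k → IRel n (comm (comm (b n i) (a n j)) (b n k))

φgen : (n : ℕ) → XY n → Fin (n + n)
φgen n = join n n

ψgen : (n : ℕ) → Fin (n + n) → XY n
ψgen n = splitAt n

{-# OPTIONS --safe #-}

-- H(n) is isomorphic to the semidirect product M = V ⋊ F₂ⁿ, where V = Rⁿ for the ring
-- R = F₂[t₁,…,tₙ] / (tᵢ², all cubic monomials) of dimension 1 + n + n(n-1)/2, xₖ acts on V by multiplication
-- with 1 + tₖ and yⱼ is the j-th unit vector. The defining relators of H(n) hold in M, so every word has an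
-- image in M. Conversely, collecting the xₖ to the right rewrites every word as a normal form
-- ∏ b^εᵦ · ∏ xₖ^sₖ over the basis yⱼ, [yⱼ,xₐ], [[yⱼ,xₐ],x_b] (b < a) of V, and the image of a normal form in
-- M recovers its exponents. Hence |H(n)| = |M| = 2^(n + n(1 + n + n(n-1)/2)) = 2^((n³+n²+4n)/2).
-- The same model makes ψ well defined: every generator of I maps to a word with trivial image in M, hence
-- trivial in H(n); for F₄ this holds because a commutator of weight k acts on V as a translation by a vector
-- of degree at least k - 1. The defining relators of H(n) are generators of I, so φ is well defined, and φ
-- and ψ are mutually inverse already on generators.
module Submission where

open import Defs
open import Data.Bool using (Bool; true; false; _∧_; _xor_; if_then_else_)
open import Data.Bool.Properties
  using (xor-same; xor-assoc; xor-comm; xor-identityʳ; ∧-zeroʳ; ∧-identityʳ; ∧-distribˡ-xor)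
open import Data.Bool.Solver using (module xor-∧-Solver)
open import Data.Empty using (⊥; ⊥-elim)
open import Data.Fin as Fin using (Fin; toℕ; splitAt; join; _↑ˡ_; _↑ʳ_; remQuot; combine)
open import Data.Fin.Properties as Finₚ
  using (splitAt-↑ˡ; splitAt-↑ʳ; splitAt-join; join-splitAt; remQuot-combine; combine-remQuot; <-cmp)
open import Data.List using (List; []; _∷_; _++_; reverse; map; [_])
open import Data.List.Properties
  using (++-assoc; ++-identityʳ; map-++; reverse-map; reverse-involutive; unfold-reverse)
open import Data.Nat using (ℕ; zero; suc; _+_; _*_; _^_; _/_; _≤_; _<_; z≤n; s≤s)
open import Data.Nat.DivMod using (m*n/n≡m)
open import Data.Nat.Properties using (<-irrefl; <-asym; ≤-pred; m<n⇒m<1+n; *-assoc)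
open import Data.Nat.Solver using (module +-*-Solver)
open import Data.Product as Product using (_×_; _,_; proj₁; proj₂; ∃; uncurry)
open import Data.Sum using (_⊎_; inj₁; inj₂; [_,_]′)
open import Data.Sum.Function.Propositional using (_⊎-↔_)
open import Data.Product.Function.NonDependent.Propositional using (_×-↔_)
open import Function.Bundles using (_↔_; mk↔ₛ′; Inverse)
open import Function.Properties.Inverse using (↔-refl; ↔-sym; ↔-trans)
open import Relation.Binary.Bundles using (Setoid)
import Relation.Binary.Reasoning.Setoid as SetoidReasoning
open import Relation.Binary.Definitions using (tri<; tri≈; tri>)
open import Relation.Binary.PropositionalEquality
  using (_≡_; _≢_; refl; sym; trans; cong; cong₂; subst; subst₂; module ≡-Reasoning)
open import Relation.Nullary using (yes; no; does)
open import Function.Base using (_∘_)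

Eqv-setoid : {G : Set} → (Word G → Set) → Setoid _ _
Eqv-setoid {G} R = record
  { Carrier = Word G
  ; _≈_ = Eqv R
  ; isEquivalence = record { refl = eqv-refl ; sym = eqv-sym ; trans = eqv-trans }
  }

module _ {G : Set} {R : Word G → Set} where

  Eqv-++ˡ : ∀ p {u v} → Eqv R u v → Eqv R (p ++ u) (p ++ v)
  Eqv-++ˡ p eqv-refl = eqv-refl
  Eqv-++ˡ p (eqv-sym e) = eqv-sym (Eqv-++ˡ p e)
  Eqv-++ˡ p (eqv-trans e f) = eqv-trans (Eqv-++ˡ p e) (Eqv-++ˡ p f)
  Eqv-++ˡ p (eqv-cancel u v l) =
    subst₂ (Eqv R) (++-assoc p u _) (++-assoc p u v) (eqv-cancel (p ++ u) v l)
  Eqv-++ˡ p (eqv-rel u v r x) =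
    subst₂ (Eqv R) (++-assoc p u _) (++-assoc p u v) (eqv-rel (p ++ u) v r x)

  Eqv-++ʳ : ∀ q {u v} → Eqv R u v → Eqv R (u ++ q) (v ++ q)
  Eqv-++ʳ q eqv-refl = eqv-refl
  Eqv-++ʳ q (eqv-sym e) = eqv-sym (Eqv-++ʳ q e)
  Eqv-++ʳ q (eqv-trans e f) = eqv-trans (Eqv-++ʳ q e) (Eqv-++ʳ q f)
  Eqv-++ʳ q (eqv-cancel u v l) =
    subst₂ (Eqv R) (sym (++-assoc u _ q)) (sym (++-assoc u v q)) (eqv-cancel u (v ++ q) l)
  Eqv-++ʳ q (eqv-rel u v r x) =
    subst₂ (Eqv R) (sym (trans (++-assoc u (r ++ v) q) (cong (u ++_) (++-assoc r v q))))
      (sym (++-assoc u v q)) (eqv-rel u (v ++ q) r x)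

  ≡⇒Eqv : ∀ {u v} → u ≡ v → Eqv R u v
  ≡⇒Eqv refl = eqv-refl

  Eqv-relator : ∀ {r} → R r → Eqv R r []
  Eqv-relator {r} x = subst (λ t → Eqv R t []) (++-identityʳ r) (eqv-rel [] [] r x)

respectsRel-fromRelators : {G H : Set} {R : Word G → Set} {S : Word H → Set} (f : G → H) →
                           (∀ r → R r → Eqv S (mapW f r) []) → RespectsRel R S f
respectsRel-fromRelators {S = S} f f-rel = go
  where
  go : ∀ u v → Eqv _ u v → Eqv S (mapW f u) (mapW f v)
  go u .u eqv-refl = eqv-refl
  go u v (eqv-sym e) = eqv-sym (go v u e)
  go u w (eqv-trans {v = v} e e′) = eqv-trans (go u v e) (go v w e′)
  go _ _ (eqv-cancel u v l) =
    subst₂ (Eqv S) (sym (map-++ _ u _)) (sym (map-++ _ u v)) (eqv-cancel (mapW f u) (mapW f v) _)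
  go _ _ (eqv-rel u v r x) =
    subst₂ (Eqv S) (sym (trans (map-++ _ u _) (cong (mapW f u ++_) (map-++ _ r v)))) (sym (map-++ _ u v))
      (Eqv-++ˡ (mapW f u) (Eqv-++ʳ (mapW f v) (f-rel r x)))

mapW-inverse : {G H : Set} {f : G → H} {g : H → G} → (∀ z → g (f z) ≡ z) → ∀ w → mapW g (mapW f w) ≡ w
mapW-inverse gf [] = refl
mapW-inverse gf ((z , b) ∷ w) = cong₂ _∷_ (cong (_, b) (gf z)) (mapW-inverse gf w)

module _ {G : Set} where

  letters : Word G → List G
  letters = map proj₁

  positive : List G → Word G
  positive = map (_, true)

  letters-positive : ∀ w → letters (positive w) ≡ w
  letters-positive [] = refl
  letters-positive (z ∷ w) = cong (z ∷_) (letters-positive w)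

  letters-invW : ∀ w → letters (invW w) ≡ reverse (letters w)
  letters-invW w = begin
    map proj₁ (reverse (map flipL w))  ≡⟨ reverse-map proj₁ (map flipL w) ⟩
    reverse (map proj₁ (map flipL w))  ≡⟨ cong reverse (map-letters-flipL w) ⟩
    reverse (letters w)                ∎
    where
    open ≡-Reasoning
    map-letters-flipL : ∀ w → map proj₁ (map flipL w) ≡ letters w
    map-letters-flipL [] = refl
    map-letters-flipL (l ∷ w) = cong (proj₁ l ∷_) (map-letters-flipL w)

  -- In a group generated by involutions, reverse w represents w⁻¹.
  comm⁺ : List G → List G → List G
  comm⁺ u v = reverse u ++ reverse v ++ u ++ v

  letters-comm : ∀ u v → letters (comm u v) ≡ comm⁺ (letters u) (letters v)
  letters-comm u v = begin
    letters (invW u ++ invW v ++ u ++ v)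
      ≡⟨ map-++ proj₁ (invW u) _ ⟩
    letters (invW u) ++ letters (invW v ++ u ++ v)
      ≡⟨ cong (letters (invW u) ++_) (map-++ proj₁ (invW v) _) ⟩
    letters (invW u) ++ letters (invW v) ++ letters (u ++ v)
      ≡⟨ cong (λ t → letters (invW u) ++ letters (invW v) ++ t) (map-++ proj₁ u v) ⟩
    letters (invW u) ++ letters (invW v) ++ letters u ++ letters v
      ≡⟨ cong₂ (λ s t → s ++ t ++ letters u ++ letters v) (letters-invW u) (letters-invW v) ⟩
    comm⁺ (letters u) (letters v) ∎
    where open ≡-Reasoning

letters-mapW : {G H : Set} (f : G → H) (w : Word G) → letters (mapW f w) ≡ map f (letters w)
letters-mapW f [] = refl
letters-mapW f (l ∷ w) = cong (f (proj₁ l) ∷_) (letters-mapW f w)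

map-comm⁺ : {A B : Set} (f : A → B) (u v : List A) → map f (comm⁺ u v) ≡ comm⁺ (map f u) (map f v)
map-comm⁺ f u v =
  trans (map-++ f (reverse u) _)
    (cong₂ _++_ (reverse-map f u)
      (trans (map-++ f (reverse v) _) (cong₂ _++_ (reverse-map f v) (map-++ f u v))))

-- When every generator is an involution the signs of letters are irrelevant, so ⟨G | R⟩ is presented on
-- unsigned words by _≈_ (positive-sound, letters-sound).
module Involutions {G : Set} (R : Word G → Set) (R-sq : ∀ z → R (sq (gen z))) where

  infix 4 _≈_
  data _≈_ : List G → List G → Set where
    ≈-refl    : ∀ {u} → u ≈ u
    ≈-sym     : ∀ {u v} → u ≈ v → v ≈ u
    ≈-trans   : ∀ {u v w} → u ≈ v → v ≈ w → u ≈ w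
    ≈-++ˡ     : ∀ p {u v} → u ≈ v → p ++ u ≈ p ++ v
    ≈-++ʳ     : ∀ q {u v} → u ≈ v → u ++ q ≈ v ++ q
    ≈-relator : ∀ {r} → R r → letters r ≈ []

  ≈-setoid : Setoid _ _
  ≈-setoid = record
    { Carrier = List G
    ; _≈_ = _≈_
    ; isEquivalence = record { refl = ≈-refl ; sym = ≈-sym ; trans = ≈-trans }
    }

  module ≈-Reasoning = SetoidReasoning ≈-setoid

  ≡⇒≈ : ∀ {u v} → u ≡ v → u ≈ v
  ≡⇒≈ refl = ≈-refl

  ≈-cong : ∀ p q {u v} → u ≈ v → p ++ u ++ q ≈ p ++ v ++ q
  ≈-cong p q e = ≈-++ˡ p (≈-++ʳ q e)

  ≈-++ : ∀ {u u′ v v′} → u ≈ u′ → v ≈ v′ → u ++ v ≈ u′ ++ v′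
  ≈-++ {u′ = u′} {v = v} e f = ≈-trans (≈-++ʳ v e) (≈-++ˡ u′ f)

  square≈[] : ∀ z → z ∷ z ∷ [] ≈ []
  square≈[] z = ≈-relator (R-sq z)

  cancel-square : ∀ z w → z ∷ z ∷ w ≈ w
  cancel-square z w = ≈-++ʳ w (square≈[] z)

  -- z⁻¹ = z⁻¹ z z = z
  sign-irrelevant : ∀ z b w → Eqv R ((z , true) ∷ w) ((z , b) ∷ w)
  sign-irrelevant z true w = eqv-refl
  sign-irrelevant z false w =
    eqv-trans (eqv-sym (eqv-cancel [] ((z , true) ∷ w) (z , false))) (eqv-rel [ z , false ] w _ (R-sq z))

  positive-letters : ∀ w → Eqv R (positive (letters w)) w
  positive-letters [] = eqv-refl
  positive-letters ((z , b) ∷ w) = eqv-trans (Eqv-++ˡ [ z , true ] (positive-letters w)) (sign-irrelevant z b w)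

  positive-sound : ∀ {u v} → u ≈ v → Eqv R (positive u) (positive v)
  positive-sound ≈-refl = eqv-refl
  positive-sound (≈-sym e) = eqv-sym (positive-sound e)
  positive-sound (≈-trans e f) = eqv-trans (positive-sound e) (positive-sound f)
  positive-sound (≈-++ˡ p {u} {v} e) =
    subst₂ (Eqv R) (sym (map-++ _ p u)) (sym (map-++ _ p v)) (Eqv-++ˡ (positive p) (positive-sound e))
  positive-sound (≈-++ʳ q {u} {v} e) =
    subst₂ (Eqv R) (sym (map-++ _ u q)) (sym (map-++ _ v q)) (Eqv-++ʳ (positive q) (positive-sound e))
  positive-sound (≈-relator {r} x) = eqv-trans (positive-letters r) (Eqv-relator x)

  letters-sound : ∀ {u v} → Eqv R u v → letters u ≈ letters v
  letters-sound eqv-refl = ≈-refl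
  letters-sound (eqv-sym e) = ≈-sym (letters-sound e)
  letters-sound (eqv-trans e f) = ≈-trans (letters-sound e) (letters-sound f)
  letters-sound (eqv-cancel u v l) =
    subst₂ _≈_ (sym (map-++ proj₁ u _)) (sym (map-++ proj₁ u v))
      (≈-cong (letters u) (letters v) (square≈[] (proj₁ l)))
  letters-sound (eqv-rel u v r x) =
    subst₂ _≈_ (sym (trans (map-++ proj₁ u _) (cong (letters u ++_) (map-++ proj₁ r v)))) (sym (map-++ proj₁ u v))
      (≈-cong (letters u) (letters v) (≈-relator x))

  inverseʳ : ∀ w → w ++ reverse w ≈ []
  inverseʳ [] = ≈-refl
  inverseʳ (z ∷ w) = begin
    z ∷ w ++ reverse (z ∷ w)        ≡⟨ cong (λ t → z ∷ w ++ t) (unfold-reverse z w) ⟩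
    z ∷ w ++ reverse w ++ [ z ]     ≡⟨ cong (z ∷_) (++-assoc w (reverse w) [ z ]) ⟨
    z ∷ (w ++ reverse w) ++ [ z ]   ≈⟨ ≈-cong [ z ] [ z ] (inverseʳ w) ⟩
    z ∷ z ∷ []                      ≈⟨ square≈[] z ⟩
    []                              ∎
    where open ≈-Reasoning

  inverseˡ : ∀ w → reverse w ++ w ≈ []
  inverseˡ w = subst (λ t → reverse w ++ t ≈ []) (reverse-involutive w) (inverseʳ (reverse w))

  ≈-cancelˡ : ∀ p {u v} → p ++ u ≈ p ++ v → u ≈ v
  ≈-cancelˡ p {u} {v} e = begin
    u                      ≈⟨ ≈-++ʳ u (inverseˡ p) ⟨
    (reverse p ++ p) ++ u  ≡⟨ ++-assoc (reverse p) p u ⟩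
    reverse p ++ p ++ u    ≈⟨ ≈-++ˡ (reverse p) e ⟩
    reverse p ++ p ++ v    ≡⟨ ++-assoc (reverse p) p v ⟨
    (reverse p ++ p) ++ v  ≈⟨ ≈-++ʳ v (inverseˡ p) ⟩
    v                      ∎
    where open ≈-Reasoning

  Commute : List G → List G → Set
  Commute u v = u ++ v ≈ v ++ u

  comm⁺≈[]⇒Commute : ∀ u v → comm⁺ u v ≈ [] → Commute u v
  comm⁺≈[]⇒Commute u v e = begin
    u ++ v                                        ≈⟨ ≈-++ʳ (u ++ v) (inverseʳ v) ⟨
    (v ++ reverse v) ++ u ++ v                    ≡⟨ ++-assoc v (reverse v) _ ⟩
    v ++ reverse v ++ u ++ v                      ≈⟨ ≈-cong v _ (inverseʳ u) ⟨
    v ++ (u ++ reverse u) ++ reverse v ++ u ++ v  ≡⟨ cong (v ++_) (++-assoc u (reverse u) _) ⟩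
    v ++ u ++ comm⁺ u v                           ≈⟨ ≈-++ˡ v (≈-++ˡ u e) ⟩
    v ++ u ++ []                                  ≡⟨ cong (v ++_) (++-identityʳ u) ⟩
    v ++ u                                        ∎
    where open ≈-Reasoning

  Commute-++ : ∀ c u v → Commute c u → Commute c v → Commute c (u ++ v)
  Commute-++ c u v cu cv = begin
    c ++ u ++ v    ≡⟨ ++-assoc c u v ⟨
    (c ++ u) ++ v  ≈⟨ ≈-++ʳ v cu ⟩
    (u ++ c) ++ v  ≡⟨ ++-assoc u c v ⟩
    u ++ c ++ v    ≈⟨ ≈-++ˡ u cv ⟩
    u ++ v ++ c    ≡⟨ ++-assoc u v c ⟨
    (u ++ v) ++ c  ∎
    where open ≈-Reasoning

  Commute-fromLetters : ∀ c → (∀ z → Commute c [ z ]) → ∀ w → Commute c w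
  Commute-fromLetters c c-z [] = ≡⇒≈ (++-identityʳ c)
  Commute-fromLetters c c-z (z ∷ w) = Commute-++ c [ z ] w (c-z z) (Commute-fromLetters c c-z w)

  conjugate-letter : ∀ z u → z ∷ u ++ [ z ] ≈ u ++ comm⁺ u [ z ]
  conjugate-letter z u = begin
    z ∷ u ++ [ z ]                      ≈⟨ ≈-++ʳ (z ∷ u ++ [ z ]) (inverseʳ u) ⟨
    (u ++ reverse u) ++ z ∷ u ++ [ z ]  ≡⟨ ++-assoc u (reverse u) _ ⟩
    u ++ comm⁺ u [ z ]                  ∎
    where open ≈-Reasoning

  conjugate-++ : ∀ z u v → z ∷ (u ++ v) ++ [ z ] ≈ (z ∷ u ++ [ z ]) ++ (z ∷ v ++ [ z ])
  conjugate-++ z u v = begin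
    z ∷ (u ++ v) ++ [ z ]               ≡⟨ cong (z ∷_) (++-assoc u v [ z ]) ⟩
    z ∷ u ++ v ++ [ z ]                 ≈⟨ ≈-++ˡ (z ∷ u) (cancel-square z _) ⟨
    z ∷ u ++ z ∷ z ∷ v ++ [ z ]         ≡⟨ cong (z ∷_) (++-assoc u [ z ] _) ⟨
    (z ∷ u ++ [ z ]) ++ (z ∷ v ++ [ z ]) ∎
    where open ≈-Reasoning

module HRelations (n : ℕ) where

  open Involutions (HRel n) h-sq public

  X Y : Fin n → XY n
  X = inj₁
  Y = inj₂

  yx : Fin n → Fin n → List (XY n)
  yx j a = comm⁺ [ Y j ] [ X a ]

  yxx : Fin n → Fin n → Fin n → List (XY n)
  yxx j a b = comm⁺ (yx j a) [ X b ]

  x-commute : ∀ a b → Commute [ X a ] [ X b ]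
  x-commute a b = comm⁺≈[]⇒Commute [ X a ] [ X b ] (≈-relator (h-xx a b))

  y-commute : ∀ j k → Commute [ Y j ] [ Y k ]
  y-commute j k = comm⁺≈[]⇒Commute [ Y j ] [ Y k ] (≈-relator (h-yy j k))

  yx-square : ∀ j a → yx j a ++ yx j a ≈ []
  yx-square j a = begin
    yx j a ++ yx j a                              ≈⟨ ≈-++ˡ (yx j a ++ yx j a) (square≈[] (Y j)) ⟨
    Y j ∷ letters (sq (comm (x n a) (y n j))) ++ [ Y j ]  ≈⟨ ≈-cong [ Y j ] [ Y j ] (≈-relator (h-xy² a j)) ⟩
    Y j ∷ Y j ∷ []                                 ≈⟨ square≈[] (Y j) ⟩
    []                                             ∎
    where open ≈-Reasoning

  reverse-yx : ∀ j a → reverse (yx j a) ≈ yx j a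
  reverse-yx j a = begin
    reverse (yx j a)                         ≈⟨ ≈-++ˡ (reverse (yx j a)) (yx-square j a) ⟨
    reverse (yx j a) ++ yx j a ++ yx j a     ≈⟨ ≈-++ʳ (yx j a) (inverseˡ (yx j a)) ⟩
    yx j a                                   ∎
    where open ≈-Reasoning

  yx-commute-y : ∀ j a k → Commute (yx j a) [ Y k ]
  yx-commute-y j a k = comm⁺≈[]⇒Commute (yx j a) [ Y k ] (≈-relator (h-yxy j a k))

  yxx-central : ∀ j a b w → Commute (yxx j a b) w
  yxx-central j a b = Commute-fromLetters (yxx j a b)
    (λ z → comm⁺≈[]⇒Commute (yxx j a b) [ z ] (≈-relator (h-zzzz (Y j) (X a) (X b) z)))

  yxx-square : ∀ j a b → yxx j a b ++ yxx j a b ≈ []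
  yxx-square j a b = ≈-trans (≈-++ yxx≈ yxx≈) (≈-relator (h-xyz² a j (X b)))
    where
    yxx≈ : yxx j a b ≈ yx j a ++ X b ∷ reverse (yx j a) ++ [ X b ]
    yxx≈ = ≈-trans (≈-++ʳ (X b ∷ yx j a ++ [ X b ]) (reverse-yx j a))
                   (≈-cong (yx j a ++ [ X b ]) [ X b ] (≈-sym (reverse-yx j a)))

  yxx-diagonal : ∀ j a → yxx j a a ≈ []
  yxx-diagonal j a =
    ≈-trans (≈-++ˡ (letters (sq (comm (x n a) (y n j)))) (square≈[] (X a))) (≈-relator (h-xy² a j))

  conjugate-x-y : ∀ k j → X k ∷ Y j ∷ X k ∷ [] ≈ Y j ∷ yx j k
  conjugate-x-y k j = conjugate-letter (X k) [ Y j ]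

  conjugate-x-yx : ∀ k j a → X k ∷ yx j a ++ [ X k ] ≈ yx j a ++ yxx j a k
  conjugate-x-yx k j a = conjugate-letter (X k) (yx j a)

  conjugate-x-yxx : ∀ k j a b → X k ∷ yxx j a b ++ [ X k ] ≈ yxx j a b
  conjugate-x-yxx k j a b = ≈-trans (≈-++ˡ [ X k ] (yxx-central j a b [ X k ])) (cancel-square (X k) (yxx j a b))

  yx-x : ∀ j a b → yx j a ++ [ X b ] ≈ X b ∷ yx j a ++ yxx j a b
  yx-x j a b = ≈-trans (≈-sym (cancel-square (X b) _)) (≈-++ˡ [ X b ] (conjugate-x-yx b j a))

  -- u = [yⱼ,xₐ] commutes with yₖ, and u x_b = x_b u c with c central of order 2, so moving u through
  -- yₖ x_b yₖ x_b produces c twice.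
  yx-commute-yx : ∀ j a k b → Commute (yx j a) (yx k b)
  yx-commute-yx j a k b = begin
    u ++ Y k ∷ X b ∷ Y k ∷ X b ∷ []           ≈⟨ ≈-cong [] (X b ∷ Y k ∷ X b ∷ []) (yx-commute-y j a k) ⟩
    Y k ∷ u ++ X b ∷ Y k ∷ X b ∷ []           ≈⟨ ≈-cong [ Y k ] (Y k ∷ X b ∷ []) (yx-x j a b) ⟩
    Y k ∷ X b ∷ u ++ c ++ Y k ∷ X b ∷ []      ≈⟨ ≈-cong (Y k ∷ X b ∷ u) [ X b ] (yxx-central j a b [ Y k ]) ⟩
    Y k ∷ X b ∷ u ++ Y k ∷ c ++ X b ∷ []      ≈⟨ ≈-cong (Y k ∷ X b ∷ []) (c ++ [ X b ]) (yx-commute-y j a k) ⟩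
    Y k ∷ X b ∷ Y k ∷ u ++ c ++ X b ∷ []      ≈⟨ ≈-cong (Y k ∷ X b ∷ Y k ∷ u) [] (yxx-central j a b [ X b ]) ⟩
    Y k ∷ X b ∷ Y k ∷ u ++ X b ∷ c            ≈⟨ ≈-cong (Y k ∷ X b ∷ Y k ∷ []) c (yx-x j a b) ⟩
    Y k ∷ X b ∷ Y k ∷ X b ∷ u ++ c ++ c       ≈⟨ ≈-cong (Y k ∷ X b ∷ Y k ∷ X b ∷ u) [] (yxx-square j a b) ⟩
    Y k ∷ X b ∷ Y k ∷ X b ∷ u ++ []           ≡⟨ cong (λ t → Y k ∷ X b ∷ Y k ∷ X b ∷ t) (++-identityʳ u) ⟩
    Y k ∷ X b ∷ Y k ∷ X b ∷ u                 ∎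
    where
    open ≈-Reasoning
    u = yx j a
    c = yxx j a b

  -- Both sides of x_b xₐ yⱼ xₐ x_b = xₐ x_b yⱼ x_b xₐ expand to yⱼ [yⱼ,xₐ] [yⱼ,x_b] times the respective yxx.
  yxx-sym : ∀ j a b → yxx j a b ≈ yxx j b a
  yxx-sym j a b = ≈-cancelˡ (Y j ∷ yx j a ++ yx j b) (begin
    (Y j ∷ yx j a ++ yx j b) ++ yxx j a b  ≈⟨ ≈-cong [ Y j ] (yxx j a b) (yx-commute-yx j a j b) ⟩
    (Y j ∷ yx j b) ++ (yx j a ++ yxx j a b) ≈⟨ expand b a ⟨
    X b ∷ X a ∷ Y j ∷ X a ∷ X b ∷ []        ≈⟨ ≈-cong [] (Y j ∷ X a ∷ X b ∷ []) (x-commute b a) ⟩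
    X a ∷ X b ∷ Y j ∷ X a ∷ X b ∷ []        ≈⟨ ≈-cong (X a ∷ X b ∷ Y j ∷ []) [] (x-commute a b) ⟩
    X a ∷ X b ∷ Y j ∷ X b ∷ X a ∷ []        ≈⟨ expand a b ⟩
    (Y j ∷ yx j a ++ yx j b) ++ yxx j b a  ∎)
    where
    open ≈-Reasoning
    expand : ∀ c d → X c ∷ X d ∷ Y j ∷ X d ∷ X c ∷ [] ≈ (Y j ∷ yx j c) ++ (yx j d ++ yxx j d c)
    expand c d = ≈-trans (≈-cong [ X c ] [ X c ] (conjugate-x-y d j))
      (≈-trans (conjugate-++ (X c) [ Y j ] (yx j d)) (≈-++ (conjugate-x-y c j) (conjugate-x-yx c j d)))

δ : ∀ {L} → Fin L → Fin L → Bool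
δ a b = does (a Finₚ.≟ b)

δ-refl : ∀ {L} (a : Fin L) → δ a a ≡ true
δ-refl a with a Finₚ.≟ a
... | yes _ = refl
... | no a≢a = ⊥-elim (a≢a refl)

δ-≢ : ∀ {L} {a b : Fin L} → a ≢ b → δ a b ≡ false
δ-≢ {a = a} {b} a≢b with a Finₚ.≟ b
... | yes a≡b = ⊥-elim (a≢b a≡b)
... | no _ = refl

δ-sym : ∀ {L} (a b : Fin L) → δ a b ≡ δ b a
δ-sym a b with a Finₚ.≟ b | b Finₚ.≟ a
... | yes _ | yes _ = refl
... | no _ | no _ = refl
... | yes a≡b | no b≢a = ⊥-elim (b≢a (sym a≡b))
... | no a≢b | yes b≡a = ⊥-elim (a≢b (sym b≡a))

δ-∧ : ∀ {L} {a b : Fin L} {x} → (a ≡ b → x ≡ false) → δ a b ∧ x ≡ false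
δ-∧ {a = a} {b} a≡b⇒x≡false with a Finₚ.≟ b
... | yes a≡b = a≡b⇒x≡false a≡b
... | no _ = refl

⨁ : ∀ {L} → (Fin L → Bool) → Bool
⨁ {zero} f = false
⨁ {suc L} f = f Fin.zero xor ⨁ (f ∘ Fin.suc)

⨁-cong : ∀ {L} {f g : Fin L → Bool} → (∀ i → f i ≡ g i) → ⨁ f ≡ ⨁ g
⨁-cong {zero} f≡g = refl
⨁-cong {suc L} f≡g = cong₂ _xor_ (f≡g Fin.zero) (⨁-cong (f≡g ∘ Fin.suc))

⨁-δ : ∀ {L} (f : Fin L → Bool) i₀ → ⨁ (λ i → f i ∧ δ i i₀) ≡ f i₀
⨁-δ {suc L} f Fin.zero =
  trans (cong₂ _xor_ (cong (f Fin.zero ∧_) (δ-refl {suc L} Fin.zero)) (⨁-∧-false (f ∘ Fin.suc)))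
        (trans (xor-identityʳ _) (∧-identityʳ _))
  where
  ⨁-∧-false : ∀ {L} (f : Fin L → Bool) → ⨁ (λ i → f i ∧ false) ≡ false
  ⨁-∧-false {zero} f = refl
  ⨁-∧-false {suc L} f = cong₂ _xor_ (∧-zeroʳ (f Fin.zero)) (⨁-∧-false (f ∘ Fin.suc))
⨁-δ {suc L} f (Fin.suc i₀) =
  trans (cong (_xor ⨁ (λ i → f (Fin.suc i) ∧ δ i i₀)) (∧-zeroʳ (f Fin.zero))) (⨁-δ (f ∘ Fin.suc) i₀)

pairs : ℕ → ℕ
pairs zero = 0
pairs (suc m) = m + pairs m

twice-pairs : ∀ m → 2 * pairs m + m ≡ m * m
twice-pairs zero = refl
twice-pairs (suc m) = begin
  2 * (m + pairs m) + suc m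
    ≡⟨ solve 2 (λ m p → con 2 :* (m :+ p) :+ (con 1 :+ m) := (con 2 :* p :+ m) :+ (con 2 :* m :+ con 1))
               refl m (pairs m) ⟩
  (2 * pairs m + m) + (2 * m + 1)
    ≡⟨ cong (_+ (2 * m + 1)) (twice-pairs m) ⟩
  m * m + (2 * m + 1)
    ≡⟨ solve 1 (λ m → m :* m :+ (con 2 :* m :+ con 1) := (con 1 :+ m) :* (con 1 :+ m)) refl m ⟩
  suc m * suc m ∎
  where
  open ≡-Reasoning
  open +-*-Solver

splitAt-injective : ∀ {m n} {i j : Fin (m + n)} → splitAt m i ≡ splitAt m j → i ≡ j
splitAt-injective {m} {n} {i} {j} eq = trans (sym (join-splitAt m n i)) (trans (cong (join m n) eq) (join-splitAt m n j))

pairAt : ∀ m → Fin (pairs m) → Fin m × Fin m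
pairAt (suc m) i = [ (λ a → Fin.suc a , Fin.zero) , (λ r → Product.map Fin.suc Fin.suc (pairAt m r)) ]′ (splitAt m i)

pairAt-< : ∀ m i → toℕ (proj₂ (pairAt m i)) < toℕ (proj₁ (pairAt m i))
pairAt-< (suc m) i with splitAt m i
... | inj₁ a = s≤s z≤n
... | inj₂ r = s≤s (pairAt-< m r)

pairIndex : ∀ m (a b : Fin m) → toℕ b < toℕ a → Fin (pairs m)
pairIndex (suc m) (Fin.suc a) Fin.zero _ = a ↑ˡ pairs m
pairIndex (suc m) (Fin.suc a) (Fin.suc b) (s≤s b<a) = m ↑ʳ pairIndex m a b b<a

pairAt-pairIndex : ∀ m a b b<a → pairAt m (pairIndex m a b b<a) ≡ (a , b)
pairAt-pairIndex (suc m) (Fin.suc a) Fin.zero _ rewrite splitAt-↑ˡ m a (pairs m) = refl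
pairAt-pairIndex (suc m) (Fin.suc a) (Fin.suc b) (s≤s b<a)
  rewrite splitAt-↑ʳ m (pairs m) (pairIndex m a b b<a) | pairAt-pairIndex m a b b<a = refl

pairAt-injective : ∀ m i i′ → pairAt m i ≡ pairAt m i′ → i ≡ i′
pairAt-injective (suc m) i i′ eq with splitAt m i in split-i | splitAt m i′ in split-i′
... | inj₁ a | inj₁ a′ = splitAt-injective (trans split-i (trans (cong inj₁ a≡a′) (sym split-i′)))
  where a≡a′ = Finₚ.suc-injective (cong proj₁ eq)
... | inj₂ r | inj₂ r′ = splitAt-injective (trans split-i (trans (cong inj₂ r≡r′) (sym split-i′)))
  where
  r≡r′ = pairAt-injective m r r′
    (cong₂ _,_ (Finₚ.suc-injective (cong proj₁ eq)) (Finₚ.suc-injective (cong proj₂ eq)))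
... | inj₁ _ | inj₂ _ with () ← cong proj₂ eq
... | inj₂ _ | inj₁ _ with () ← cong proj₂ eq

module Model (n : ℕ) where

  open xor-∧-Solver using (solve; _:+_; _:*_; _:=_; con)

  data Monomial : Set where
    one    : Monomial
    single : Fin n → Monomial
    pair   : Fin (pairs n) → Monomial

  degree : Monomial → ℕ
  degree one = 0
  degree (single _) = 1
  degree (pair _) = 2

  pair₁ pair₂ : Fin (pairs n) → Fin n
  pair₁ i = proj₁ (pairAt n i)
  pair₂ i = proj₂ (pairAt n i)

  pair₁≢pair₂ : ∀ i → pair₁ i ≢ pair₂ i
  pair₁≢pair₂ i eq = <-irrefl (cong toℕ (sym eq)) (pairAt-< n i)

  -- V = Rⁿ as coefficient functions: single a is tₐ and pair i is tₐ t_b for (a , b) = pairAt n i.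
  V : Set
  V = Fin n → Monomial → Bool

  infixl 6 _⊕_
  _⊕_ : V → V → V
  (v ⊕ w) j m = v j m xor w j m

  0V : V
  0V j m = false

  unit : Fin n → V
  unit j j′ one = δ j j′
  unit j j′ (single _) = false
  unit j j′ (pair _) = false

  infix 4 _≋_
  _≋_ : V → V → Set
  v ≋ w = ∀ j m → v j m ≡ w j m

  ≋-setoid : Setoid _ _
  ≋-setoid = record
    { Carrier = V
    ; _≈_ = _≋_
    ; isEquivalence = record
      { refl = λ j m → refl
      ; sym = λ e j m → sym (e j m)
      ; trans = λ e f j m → trans (e j m) (f j m)
      }
    }

  open Setoid ≋-setoid public using () renaming (refl to ≋-refl; sym to ≋-sym; trans to ≋-trans)
  module ≋-Reasoning = SetoidReasoning ≋-setoid

  ⊕-cong : ∀ {a b c d} → a ≋ b → c ≋ d → a ⊕ c ≋ b ⊕ d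
  ⊕-cong e f j m = cong₂ _xor_ (e j m) (f j m)

  ⊕-self : ∀ v → v ⊕ v ≋ 0V
  ⊕-self v j m = xor-same (v j m)

  mulT : Fin n → V → V
  mulT k v j one = false
  mulT k v j (single a) = δ a k ∧ v j one
  mulT k v j (pair i) = (δ (pair₁ i) k ∧ v j (single (pair₂ i))) xor (δ (pair₂ i) k ∧ v j (single (pair₁ i)))

  act : Fin n → V → V
  act k v = v ⊕ mulT k v

  mulT-cong : ∀ k {v w} → v ≋ w → mulT k v ≋ mulT k w
  mulT-cong k e j one = refl
  mulT-cong k e j (single a) = cong (δ a k ∧_) (e j one)
  mulT-cong k e j (pair i) =
    cong₂ (λ s t → (δ (pair₁ i) k ∧ s) xor (δ (pair₂ i) k ∧ t)) (e j (single (pair₂ i))) (e j (single (pair₁ i)))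

  mulT-⊕ : ∀ k v w → mulT k (v ⊕ w) ≋ mulT k v ⊕ mulT k w
  mulT-⊕ k v w j one = refl
  mulT-⊕ k v w j (single a) = ∧-distribˡ-xor (δ a k) (v j one) (w j one)
  mulT-⊕ k v w j (pair i) =
    solve 6 (λ p q a b c d → (p :* (a :+ b)) :+ (q :* (c :+ d)) := ((p :* a) :+ (q :* c)) :+ ((p :* b) :+ (q :* d))) refl
      (δ (pair₁ i) k) (δ (pair₂ i) k) (v j (single (pair₂ i))) (w j (single (pair₂ i)))
      (v j (single (pair₁ i))) (w j (single (pair₁ i)))

  mulT-0 : ∀ k → mulT k 0V ≋ 0V
  mulT-0 k j one = refl
  mulT-0 k j (single a) = ∧-zeroʳ (δ a k)
  mulT-0 k j (pair i) = cong₂ _xor_ (∧-zeroʳ (δ (pair₁ i) k)) (∧-zeroʳ (δ (pair₂ i) k))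

  mulT-mulT : ∀ k v → mulT k (mulT k v) ≋ 0V
  mulT-mulT k v j one = refl
  mulT-mulT k v j (single a) = ∧-zeroʳ (δ a k)
  mulT-mulT k v j (pair i) =
    solve 3 (λ p q x → (p :* (q :* x)) :+ (q :* (p :* x)) := con false) refl (δ (pair₁ i) k) (δ (pair₂ i) k) (v j one)

  mulT-comm : ∀ a b v → mulT a (mulT b v) ≋ mulT b (mulT a v)
  mulT-comm a b v j one = refl
  mulT-comm a b v j (single c) = trans (∧-zeroʳ (δ c a)) (sym (∧-zeroʳ (δ c b)))
  mulT-comm a b v j (pair i) =
    solve 5 (λ pa pb qa qb x → (pa :* (qb :* x)) :+ (qa :* (pb :* x)) := (pb :* (qa :* x)) :+ (qb :* (pa :* x))) refl
      (δ (pair₁ i) a) (δ (pair₁ i) b) (δ (pair₂ i) a) (δ (pair₂ i) b) (v j one)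

  act-cong : ∀ k {v w} → v ≋ w → act k v ≋ act k w
  act-cong k e = ⊕-cong e (mulT-cong k e)

  act-⊕ : ∀ k v w → act k (v ⊕ w) ≋ act k v ⊕ act k w
  act-⊕ k v w j m rewrite mulT-⊕ k v w j m =
    solve 4 (λ a b c d → (a :+ b) :+ (c :+ d) := (a :+ c) :+ (b :+ d)) refl (v j m) (w j m) (mulT k v j m) (mulT k w j m)

  act-0 : ∀ k → act k 0V ≋ 0V
  act-0 = mulT-0

  act-involutive : ∀ k v → act k (act k v) ≋ v
  act-involutive k v j m rewrite mulT-⊕ k v (mulT k v) j m | mulT-mulT k v j m =
    solve 2 (λ a b → (a :+ b) :+ (b :+ con false) := a) refl (v j m) (mulT k v j m)

  act-comm : ∀ a b v → act a (act b v) ≋ act b (act a v)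
  act-comm a b v j m rewrite mulT-⊕ a v (mulT b v) j m | mulT-⊕ b v (mulT a v) j m | mulT-comm a b v j m =
    solve 4 (λ x p q r → (x :+ q) :+ (p :+ r) := (x :+ p) :+ (q :+ r)) refl
      (v j m) (mulT a v j m) (mulT b v j m) (mulT b (mulT a v) j m)

  act-one : ∀ k v j → act k v j one ≡ v j one
  act-one k v j = xor-identityʳ (v j one)

  act-⊕-self : ∀ k v → act k v ⊕ v ≋ mulT k v
  act-⊕-self k v j m = solve 2 (λ a b → (a :+ b) :+ a := b) refl (v j m) (mulT k v j m)

  -- A word w acts on V by the affine map v ↦ linPart w v ⊕ vecPart w, the letter xₖ by act k and yⱼ by
  -- translation by unit j; parity w k counts the letters xₖ modulo 2.
  linPart : List (XY n) → V → V
  linPart [] v = v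
  linPart (inj₁ k ∷ w) v = act k (linPart w v)
  linPart (inj₂ j ∷ w) v = linPart w v

  vecPart : List (XY n) → V
  vecPart [] = 0V
  vecPart (inj₁ k ∷ w) = act k (vecPart w)
  vecPart (inj₂ j ∷ w) = vecPart w ⊕ unit j

  parity : List (XY n) → Fin n → Bool
  parity [] k = false
  parity (inj₁ a ∷ w) k = parity w k xor δ a k
  parity (inj₂ j ∷ w) k = parity w k

  linPart-cong : ∀ w {v v′} → v ≋ v′ → linPart w v ≋ linPart w v′
  linPart-cong [] e = e
  linPart-cong (inj₁ k ∷ w) e = act-cong k (linPart-cong w e)
  linPart-cong (inj₂ j ∷ w) e = linPart-cong w e

  linPart-⊕ : ∀ w v v′ → linPart w (v ⊕ v′) ≋ linPart w v ⊕ linPart w v′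
  linPart-⊕ [] v v′ = ≋-refl
  linPart-⊕ (inj₁ k ∷ w) v v′ = ≋-trans (act-cong k (linPart-⊕ w v v′)) (act-⊕ k (linPart w v) (linPart w v′))
  linPart-⊕ (inj₂ j ∷ w) v v′ = linPart-⊕ w v v′

  linPart-0 : ∀ w → linPart w 0V ≋ 0V
  linPart-0 [] = ≋-refl
  linPart-0 (inj₁ k ∷ w) = ≋-trans (act-cong k (linPart-0 w)) (act-0 k)
  linPart-0 (inj₂ j ∷ w) = linPart-0 w

  linPart-++ : ∀ u w v → linPart (u ++ w) v ≡ linPart u (linPart w v)
  linPart-++ [] w v = refl
  linPart-++ (inj₁ k ∷ u) w v = cong (act k) (linPart-++ u w v)
  linPart-++ (inj₂ j ∷ u) w v = linPart-++ u w v

  linPart-one : ∀ w v j → linPart w v j one ≡ v j one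
  linPart-one [] v j = refl
  linPart-one (inj₁ k ∷ w) v j = trans (act-one k (linPart w v) j) (linPart-one w v j)
  linPart-one (inj₂ i ∷ w) v j = linPart-one w v j

  linPart-square : ∀ z w v → linPart (z ∷ z ∷ w) v ≋ linPart w v
  linPart-square (inj₁ k) w v = act-involutive k (linPart w v)
  linPart-square (inj₂ j) w v = ≋-refl

  linPart-reverse : ∀ w v → linPart (reverse w) (linPart w v) ≋ v
  linPart-reverse [] v = ≋-refl
  linPart-reverse (z ∷ w) v = begin
    linPart (reverse (z ∷ w)) (linPart (z ∷ w) v)
      ≡⟨ cong (λ t → linPart t (linPart (z ∷ w) v)) (unfold-reverse z w) ⟩
    linPart (reverse w ++ [ z ]) (linPart (z ∷ w) v)
      ≡⟨ linPart-++ (reverse w) [ z ] (linPart (z ∷ w) v) ⟩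
    linPart (reverse w) (linPart [ z ] (linPart (z ∷ w) v))
      ≡⟨ cong (linPart (reverse w)) (linPart-++ [ z ] (z ∷ w) v) ⟨
    linPart (reverse w) (linPart (z ∷ z ∷ w) v)
      ≈⟨ linPart-cong (reverse w) (linPart-square z w v) ⟩
    linPart (reverse w) (linPart w v)
      ≈⟨ linPart-reverse w v ⟩
    v ∎
    where open ≋-Reasoning

  act-linPart : ∀ k w v → act k (linPart w v) ≋ linPart w (act k v)
  act-linPart k [] v = ≋-refl
  act-linPart k (inj₁ b ∷ w) v = ≋-trans (act-comm k b (linPart w v)) (act-cong b (act-linPart k w v))
  act-linPart k (inj₂ j ∷ w) v = act-linPart k w v

  linPart-comm : ∀ u w v → linPart u (linPart w v) ≋ linPart w (linPart u v)
  linPart-comm [] w v = ≋-refl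
  linPart-comm (inj₁ k ∷ u) w v = ≋-trans (act-cong k (linPart-comm u w v)) (act-linPart k w (linPart u v))
  linPart-comm (inj₂ j ∷ u) w v = linPart-comm u w v

  vecPart-++ : ∀ u w → vecPart (u ++ w) ≋ linPart u (vecPart w) ⊕ vecPart u
  vecPart-++ [] w j m = sym (xor-identityʳ _)
  vecPart-++ (inj₁ k ∷ u) w = ≋-trans (act-cong k (vecPart-++ u w)) (act-⊕ k (linPart u (vecPart w)) (vecPart u))
  vecPart-++ (inj₂ i ∷ u) w j m =
    trans (cong (_xor unit i j m) (vecPart-++ u w j m)) (xor-assoc (linPart u (vecPart w) j m) (vecPart u j m) (unit i j m))

  parity-++ : ∀ u w k → parity (u ++ w) k ≡ parity w k xor parity u k
  parity-++ [] w k = sym (xor-identityʳ _)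
  parity-++ (inj₁ a ∷ u) w k = trans (cong (_xor δ a k) (parity-++ u w k)) (xor-assoc (parity w k) (parity u k) (δ a k))
  parity-++ (inj₂ j ∷ u) w k = parity-++ u w k

  vecPart-square : ∀ z w → vecPart (z ∷ z ∷ w) ≋ vecPart w
  vecPart-square (inj₁ k) w = act-involutive k (vecPart w)
  vecPart-square (inj₂ i) w j m =
    trans (xor-assoc (vecPart w j m) (unit i j m) (unit i j m))
          (trans (cong (vecPart w j m xor_) (xor-same (unit i j m))) (xor-identityʳ _))

  parity-square : ∀ z w k → parity (z ∷ z ∷ w) k ≡ parity w k
  parity-square (inj₁ a) w k =
    trans (xor-assoc (parity w k) (δ a k) (δ a k)) (trans (cong (parity w k xor_) (xor-same (δ a k))) (xor-identityʳ _))
  parity-square (inj₂ i) w k = refl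

  reverse-∷-++-∷ : ∀ (z : XY n) w → reverse (z ∷ w) ++ z ∷ w ≡ reverse w ++ z ∷ z ∷ w
  reverse-∷-++-∷ z w = trans (cong (_++ z ∷ w) (unfold-reverse z w)) (++-assoc (reverse w) [ z ] (z ∷ w))

  vecPart-inverseˡ : ∀ w → vecPart (reverse w ++ w) ≋ 0V
  vecPart-inverseˡ [] = ≋-refl
  vecPart-inverseˡ (z ∷ w) = begin
    vecPart (reverse (z ∷ w) ++ z ∷ w)
      ≡⟨ cong vecPart (reverse-∷-++-∷ z w) ⟩
    vecPart (reverse w ++ z ∷ z ∷ w)
      ≈⟨ vecPart-++ (reverse w) (z ∷ z ∷ w) ⟩
    linPart (reverse w) (vecPart (z ∷ z ∷ w)) ⊕ vecPart (reverse w)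
      ≈⟨ ⊕-cong (linPart-cong (reverse w) (vecPart-square z w)) ≋-refl ⟩
    linPart (reverse w) (vecPart w) ⊕ vecPart (reverse w)
      ≈⟨ vecPart-++ (reverse w) w ⟨
    vecPart (reverse w ++ w)
      ≈⟨ vecPart-inverseˡ w ⟩
    0V ∎
    where open ≋-Reasoning

  parity-inverseˡ : ∀ w k → parity (reverse w ++ w) k ≡ false
  parity-inverseˡ [] k = refl
  parity-inverseˡ (z ∷ w) k = begin
    parity (reverse (z ∷ w) ++ z ∷ w) k
      ≡⟨ cong (λ t → parity t k) (reverse-∷-++-∷ z w) ⟩
    parity (reverse w ++ z ∷ z ∷ w) k
      ≡⟨ parity-++ (reverse w) (z ∷ z ∷ w) k ⟩
    parity (z ∷ z ∷ w) k xor parity (reverse w) k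
      ≡⟨ cong (_xor parity (reverse w) k) (parity-square z w k) ⟩
    parity w k xor parity (reverse w) k
      ≡⟨ parity-++ (reverse w) w k ⟨
    parity (reverse w ++ w) k
      ≡⟨ parity-inverseˡ w k ⟩
    false ∎
    where open ≡-Reasoning

  xor≡false⇒≡ : ∀ {a b} → a xor b ≡ false → b ≡ a
  xor≡false⇒≡ {false} {false} _ = refl
  xor≡false⇒≡ {true} {true} _ = refl

  vecPart-reverse : ∀ w → vecPart (reverse w) ≋ linPart (reverse w) (vecPart w)
  vecPart-reverse w j m = xor≡false⇒≡ (trans (sym (vecPart-++ (reverse w) w j m)) (vecPart-inverseˡ w j m))

  parity-reverse : ∀ w k → parity (reverse w) k ≡ parity w k
  parity-reverse w k = xor≡false⇒≡ (trans (sym (parity-++ (reverse w) w k)) (parity-inverseˡ w k))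

  Deg≥ : ℕ → V → Set
  Deg≥ d c = ∀ j m → degree m < d → c j m ≡ false

  Deg≥-cong : ∀ {d c c′} → c ≋ c′ → Deg≥ d c → Deg≥ d c′
  Deg≥-cong e f j m lt = trans (sym (e j m)) (f j m lt)

  Deg≥-⊕ : ∀ {d a b} → Deg≥ d a → Deg≥ d b → Deg≥ d (a ⊕ b)
  Deg≥-⊕ fa fb j m lt rewrite fa j m lt | fb j m lt = refl

  Deg≥-weaken : ∀ {d c} → Deg≥ (suc d) c → Deg≥ d c
  Deg≥-weaken f j m lt = f j m (m<n⇒m<1+n lt)

  Deg≥-3 : ∀ {c} → Deg≥ 3 c → c ≋ 0V
  Deg≥-3 f j one = f j one (s≤s z≤n)
  Deg≥-3 f j (single a) = f j (single a) (s≤s (s≤s z≤n))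
  Deg≥-3 f j (pair i) = f j (pair i) (s≤s (s≤s (s≤s z≤n)))

  mulT-Deg≥ : ∀ a {d c} → Deg≥ d c → Deg≥ (suc d) (mulT a c)
  mulT-Deg≥ a f j one lt = refl
  mulT-Deg≥ a f j (single b) lt rewrite f j one (≤-pred lt) = ∧-zeroʳ (δ b a)
  mulT-Deg≥ a f j (pair i) lt
    rewrite f j (single (pair₂ i)) (≤-pred lt) | f j (single (pair₁ i)) (≤-pred lt) =
    cong₂ _xor_ (∧-zeroʳ (δ (pair₁ i) a)) (∧-zeroʳ (δ (pair₂ i) a))

  -- Each act k is the identity modulo mulT, which raises the degree.
  linPart-Deg≥ : ∀ x {d c} → Deg≥ d c → Deg≥ (suc d) (linPart x c ⊕ c)
  linPart-Deg≥ [] {c = c} f j m lt = xor-same (c j m)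
  linPart-Deg≥ (inj₁ a ∷ x) {d} {c} f j m lt =
    trans (cong (λ t → (linPart x c j m xor t) xor c j m) (mulT-Deg≥ a linPart-x-Deg≥ j m lt))
          (trans (cong (_xor c j m) (xor-identityʳ (linPart x c j m))) (linPart-Deg≥ x f j m lt))
    where
    linPart-x-Deg≥ : Deg≥ d (linPart x c)
    linPart-x-Deg≥ = Deg≥-cong (λ j m → solve 2 (λ p q → (p :+ q) :+ q := p) refl (linPart x c j m) (c j m))
                                       (Deg≥-⊕ (Deg≥-weaken (linPart-Deg≥ x f)) f)
  linPart-Deg≥ (inj₂ i ∷ x) f = linPart-Deg≥ x f

  LinearlyTrivial : List (XY n) → Set
  LinearlyTrivial w = ∀ v → linPart w v ≋ v

  IsTranslation : List (XY n) → Set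
  IsTranslation w = LinearlyTrivial w × (∀ k → parity w k ≡ false)

  Γ : ℕ → List (XY n) → Set
  Γ d w = IsTranslation w × Deg≥ d (vecPart w)

  Trivial : List (XY n) → Set
  Trivial w = IsTranslation w × vecPart w ≋ 0V

  LinearlyTrivial-reverse : ∀ w → LinearlyTrivial w → LinearlyTrivial (reverse w)
  LinearlyTrivial-reverse w lw v = ≋-trans (linPart-cong (reverse w) (≋-sym (lw v))) (linPart-reverse w v)

  LinearlyTrivial-++ : ∀ u w → LinearlyTrivial u → LinearlyTrivial w → LinearlyTrivial (u ++ w)
  LinearlyTrivial-++ u w lu lw v j m = trans (cong (λ t → t j m) (linPart-++ u w v)) (trans (lu (linPart w v) j m) (lw v j m))

  LinearlyTrivial-comm⁺ : ∀ u w → LinearlyTrivial (comm⁺ u w)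
  LinearlyTrivial-comm⁺ u w v = begin
    linPart (reverse u ++ reverse w ++ u ++ w) v
      ≡⟨ linPart-++ (reverse u) _ v ⟩
    linPart (reverse u) (linPart (reverse w ++ u ++ w) v)
      ≡⟨ cong (linPart (reverse u)) (linPart-++ (reverse w) _ v) ⟩
    linPart (reverse u) (linPart (reverse w) (linPart (u ++ w) v))
      ≡⟨ cong (λ t → linPart (reverse u) (linPart (reverse w) t)) (linPart-++ u w v) ⟩
    linPart (reverse u) (linPart (reverse w) (linPart u (linPart w v)))
      ≈⟨ linPart-cong (reverse u) (linPart-cong (reverse w) (linPart-comm u w v)) ⟩
    linPart (reverse u) (linPart (reverse w) (linPart w (linPart u v)))
      ≈⟨ linPart-cong (reverse u) (linPart-reverse w (linPart u v)) ⟩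
    linPart (reverse u) (linPart u v)
      ≈⟨ linPart-reverse u v ⟩
    v ∎
    where open ≋-Reasoning

  parity-comm⁺ : ∀ u w k → parity (comm⁺ u w) k ≡ false
  parity-comm⁺ u w k
    rewrite parity-++ (reverse u) (reverse w ++ u ++ w) k | parity-++ (reverse w) (u ++ w) k | parity-++ u w k
          | parity-reverse u k | parity-reverse w k =
    solve 2 (λ a b → ((b :+ a) :+ b) :+ a := con false) refl (parity u k) (parity w k)

  IsTranslation-comm⁺ : ∀ u w → IsTranslation (comm⁺ u w)
  IsTranslation-comm⁺ u w = LinearlyTrivial-comm⁺ u w , parity-comm⁺ u w

  IsTranslation-++ : ∀ u w → IsTranslation u → IsTranslation w → IsTranslation (u ++ w)
  IsTranslation-++ u w (lu , pu) (lw , pw) =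
    LinearlyTrivial-++ u w lu lw , λ k → trans (parity-++ u w k) (cong₂ _xor_ (pw k) (pu k))

  IsTranslation-reverse : ∀ u → IsTranslation u → IsTranslation (reverse u)
  IsTranslation-reverse u (lu , pu) = LinearlyTrivial-reverse u lu , λ k → trans (parity-reverse u k) (pu k)

  vecPart-translation-++ : ∀ u w → LinearlyTrivial u → vecPart (u ++ w) ≋ vecPart w ⊕ vecPart u
  vecPart-translation-++ u w lu = ≋-trans (vecPart-++ u w) (⊕-cong (lu (vecPart w)) ≋-refl)

  vecPart-translation-reverse : ∀ u → LinearlyTrivial u → vecPart (reverse u) ≋ vecPart u
  vecPart-translation-reverse u lu = ≋-trans (vecPart-reverse u) (LinearlyTrivial-reverse u lu (vecPart u))

  vecPart-one-++ : ∀ u w j → vecPart (u ++ w) j one ≡ vecPart w j one xor vecPart u j one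
  vecPart-one-++ u w j = trans (vecPart-++ u w j one) (cong (_xor vecPart u j one) (linPart-one u (vecPart w) j))

  vecPart-one-reverse : ∀ u j → vecPart (reverse u) j one ≡ vecPart u j one
  vecPart-one-reverse u j = trans (vecPart-reverse u j one) (linPart-one (reverse u) (vecPart u) j)

  vecPart-one-comm⁺ : ∀ u w j → vecPart (comm⁺ u w) j one ≡ false
  vecPart-one-comm⁺ u w j
    rewrite vecPart-one-++ (reverse u) (reverse w ++ u ++ w) j | vecPart-one-++ (reverse w) (u ++ w) j
          | vecPart-one-++ u w j | vecPart-one-reverse u j | vecPart-one-reverse w j =
    solve 2 (λ a b → ((b :+ a) :+ b) :+ a := con false) refl (vecPart u j one) (vecPart w j one)

  Γ₁-comm⁺ : ∀ u w → Γ 1 (comm⁺ u w)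
  Γ₁-comm⁺ u w = IsTranslation-comm⁺ u w , filtered
    where
    filtered : Deg≥ 1 (vecPart (comm⁺ u w))
    filtered j one _ = vecPart-one-comm⁺ u w j
    filtered j (single a) (s≤s ())
    filtered j (pair i) (s≤s ())

  vecPart-comm⁺ : ∀ u w → LinearlyTrivial u → vecPart (comm⁺ u w) ≋ linPart (reverse w) (vecPart u) ⊕ vecPart u
  vecPart-comm⁺ u w lu = begin
    vecPart (reverse u ++ reverse w ++ u ++ w)
      ≈⟨ vecPart-translation-++ (reverse u) _ (LinearlyTrivial-reverse u lu) ⟩
    vecPart (reverse w ++ u ++ w) ⊕ vecPart (reverse u)
      ≈⟨ ⊕-cong (vecPart-++ (reverse w) (u ++ w)) (vecPart-translation-reverse u lu) ⟩
    linPart (reverse w) (vecPart (u ++ w)) ⊕ vecPart (reverse w) ⊕ vecPart u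
      ≈⟨ ⊕-cong (⊕-cong (linPart-cong (reverse w) (vecPart-translation-++ u w lu)) (vecPart-reverse w)) ≋-refl ⟩
    linPart (reverse w) (vecPart w ⊕ vecPart u) ⊕ linPart (reverse w) (vecPart w) ⊕ vecPart u
      ≈⟨ ⊕-cong (⊕-cong (linPart-⊕ (reverse w) (vecPart w) (vecPart u)) ≋-refl) ≋-refl ⟩
    linPart (reverse w) (vecPart w) ⊕ linPart (reverse w) (vecPart u) ⊕ linPart (reverse w) (vecPart w) ⊕ vecPart u
      ≈⟨ (λ j m → solve 3 (λ a b c → ((a :+ b) :+ a) :+ c := b :+ c) refl
                    (linPart (reverse w) (vecPart w) j m) (linPart (reverse w) (vecPart u) j m) (vecPart u j m)) ⟩
    linPart (reverse w) (vecPart u) ⊕ vecPart u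
      ∎
    where open ≋-Reasoning

  vecPart-comm⁺-x : ∀ u k → LinearlyTrivial u → vecPart (comm⁺ u [ inj₁ k ]) ≋ mulT k (vecPart u)
  vecPart-comm⁺-x u k lu = ≋-trans (vecPart-comm⁺ u [ inj₁ k ] lu) (act-⊕-self k (vecPart u))

  Γ-comm⁺ : ∀ d u w → Γ d u → Γ (suc d) (comm⁺ u w)
  Γ-comm⁺ d u w ((lu , pu) , fu) =
    IsTranslation-comm⁺ u w , Deg≥-cong (≋-sym (vecPart-comm⁺ u w lu)) (linPart-Deg≥ (reverse w) fu)

  Γ-++ : ∀ d u w → Γ d u → Γ d w → Γ d (u ++ w)
  Γ-++ d u w (tu , fu) (tw , fw) =
    IsTranslation-++ u w tu tw , Deg≥-cong (≋-sym (vecPart-translation-++ u w (proj₁ tu))) (Deg≥-⊕ fw fu)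

  Γ-reverse : ∀ d u → Γ d u → Γ d (reverse u)
  Γ-reverse d u (tu , fu) =
    IsTranslation-reverse u tu , Deg≥-cong (≋-sym (vecPart-translation-reverse u (proj₁ tu))) fu

  Γ-[] : ∀ d → Γ d []
  Γ-[] d = ((λ v → ≋-refl) , (λ k → refl)) , (λ j m lt → refl)

  Γ₃⇒Trivial : ∀ u → Γ 3 u → Trivial u
  Γ₃⇒Trivial u (tu , fu) = tu , Deg≥-3 fu

  Trivial-square : ∀ u → IsTranslation u → Trivial (u ++ u)
  Trivial-square u tu = IsTranslation-++ u u tu tu , ≋-trans (vecPart-translation-++ u u (proj₁ tu)) (⊕-self (vecPart u))

  Trivial-comm⁺ : ∀ u w → Trivial u → Trivial (comm⁺ u w)
  Trivial-comm⁺ u w ((lu , _) , vu) =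
    IsTranslation-comm⁺ u w ,
    ≋-trans (vecPart-comm⁺ u w lu)
      (≋-trans (⊕-cong (≋-trans (linPart-cong (reverse w) vu) (linPart-0 (reverse w))) vu) (⊕-self 0V))

  Trivial-comm⁺-LinearlyTrivial : ∀ u w → IsTranslation u → LinearlyTrivial w → Trivial (comm⁺ u w)
  Trivial-comm⁺-LinearlyTrivial u w (lu , _) lw =
    IsTranslation-comm⁺ u w ,
    ≋-trans (vecPart-comm⁺ u w lu)
      (≋-trans (⊕-cong (LinearlyTrivial-reverse w lw (vecPart u)) ≋-refl) (⊕-self (vecPart u)))

module Soundness (n : ℕ) where

  open HRelations n public
  open Model n public

  SameImage : List (XY n) → List (XY n) → Set
  SameImage u v = (∀ x → linPart u x ≋ linPart v x) × vecPart u ≋ vecPart v × (∀ k → parity u k ≡ parity v k)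

  SameImage-++ˡ : ∀ p {u v} → SameImage u v → SameImage (p ++ u) (p ++ v)
  SameImage-++ˡ p {u} {v} (lin , vec , par) =
    (λ x j m → trans (cong (λ t → t j m) (linPart-++ p u x))
                 (trans (linPart-cong p (lin x) j m) (cong (λ t → t j m) (sym (linPart-++ p v x))))) ,
    ≋-trans (vecPart-++ p u) (≋-trans (⊕-cong (linPart-cong p vec) ≋-refl) (≋-sym (vecPart-++ p v))) ,
    (λ k → trans (parity-++ p u k) (trans (cong (_xor parity p k) (par k)) (sym (parity-++ p v k))))

  SameImage-++ʳ : ∀ q {u v} → SameImage u v → SameImage (u ++ q) (v ++ q)
  SameImage-++ʳ q {u} {v} (lin , vec , par) =
    (λ x j m → trans (cong (λ t → t j m) (linPart-++ u q x))
                 (trans (lin (linPart q x) j m) (cong (λ t → t j m) (sym (linPart-++ v q x))))) ,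
    ≋-trans (vecPart-++ u q) (≋-trans (⊕-cong (lin (vecPart q)) vec) (≋-sym (vecPart-++ v q))) ,
    (λ k → trans (parity-++ u q k) (trans (cong (parity q k xor_) (par k)) (sym (parity-++ v q k))))

  y-IsTranslation : ∀ j → IsTranslation [ Y j ]
  y-IsTranslation j = (λ v → ≋-refl) , (λ k → refl)

  relator-Trivial : ∀ {r} → HRel n r → Trivial (letters r)
  relator-Trivial (h-sq z) = (linPart-square z [] , parity-square z []) , vecPart-square z []
  relator-Trivial (h-xx i j) =
    IsTranslation-comm⁺ [ X i ] [ X j ] ,
    ≋-trans (act-cong i (≋-trans (act-cong j (≋-trans (act-cong i (act-0 j)) (act-0 i))) (act-0 j))) (act-0 i)
  relator-Trivial (h-yy i j) = Trivial-comm⁺-LinearlyTrivial [ Y i ] [ Y j ] (y-IsTranslation i) (λ v → ≋-refl)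
  relator-Trivial (h-xy² i j) = Trivial-square (comm⁺ [ X i ] [ Y j ]) (IsTranslation-comm⁺ [ X i ] [ Y j ])
  relator-Trivial (h-yxy i j k) =
    Trivial-comm⁺-LinearlyTrivial (yx i j) [ Y k ] (IsTranslation-comm⁺ [ Y i ] [ X j ]) (λ v → ≋-refl)
  relator-Trivial (h-xyz² i j z) =
    Trivial-square (comm⁺ (comm⁺ [ X i ] [ Y j ]) [ z ]) (IsTranslation-comm⁺ (comm⁺ [ X i ] [ Y j ]) [ z ])
  relator-Trivial (h-zzzz z z′ z″ z‴) =
    Γ₃⇒Trivial (comm⁺ zzz [ z‴ ]) (Γ-comm⁺ 2 zzz [ z‴ ] (Γ-comm⁺ 1 zz [ z″ ] (Γ₁-comm⁺ [ z ] [ z′ ])))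
    where
    zz = comm⁺ [ z ] [ z′ ]
    zzz = comm⁺ zz [ z″ ]

  Trivial⇒SameImage[] : ∀ {w} → Trivial w → SameImage w []
  Trivial⇒SameImage[] ((lin , par) , vec) = lin , vec , par

  ≈⇒SameImage : ∀ {u v} → u ≈ v → SameImage u v
  ≈⇒SameImage ≈-refl = (λ x → ≋-refl) , ≋-refl , (λ k → refl)
  ≈⇒SameImage (≈-sym e) with ≈⇒SameImage e
  ... | lin , vec , par = (λ x → ≋-sym (lin x)) , ≋-sym vec , (λ k → sym (par k))
  ≈⇒SameImage (≈-trans e f) with ≈⇒SameImage e | ≈⇒SameImage f
  ... | lin , vec , par | lin′ , vec′ , par′ =
    (λ x → ≋-trans (lin x) (lin′ x)) , ≋-trans vec vec′ , (λ k → trans (par k) (par′ k))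
  ≈⇒SameImage (≈-++ˡ p {u} {v} e) = SameImage-++ˡ p {u} {v} (≈⇒SameImage e)
  ≈⇒SameImage (≈-++ʳ q {u} {v} e) = SameImage-++ʳ q {u} {v} (≈⇒SameImage e)
  ≈⇒SameImage (≈-relator {r} x) = Trivial⇒SameImage[] {letters r} (relator-Trivial x)

  vecPart-yx : ∀ j a → vecPart (yx j a) ≋ mulT a (unit j)
  vecPart-yx j a = vecPart-comm⁺-x [ Y j ] a (λ v → ≋-refl)

  vecPart-yxx : ∀ j a b → vecPart (yxx j a b) ≋ mulT b (mulT a (unit j))
  vecPart-yxx j a b =
    ≋-trans (vecPart-comm⁺-x (yx j a) b (LinearlyTrivial-comm⁺ [ Y j ] [ X a ])) (mulT-cong b (vecPart-yx j a))

module NormalForms (n : ℕ) where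

  open Soundness n public

  Basis : Set
  Basis = Fin n × Monomial

  basisWord : Basis → List (XY n)
  basisWord (j , one) = [ Y j ]
  basisWord (j , single a) = yx j a
  basisWord (j , pair i) = yxx j (pair₁ i) (pair₂ i)

  basisWord-square : ∀ t → basisWord t ++ basisWord t ≈ []
  basisWord-square (j , one) = square≈[] (Y j)
  basisWord-square (j , single a) = yx-square j a
  basisWord-square (j , pair i) = yxx-square j (pair₁ i) (pair₂ i)

  basisWord-commute : ∀ t t′ → Commute (basisWord t) (basisWord t′)
  basisWord-commute (j , one) (k , one) = y-commute j k
  basisWord-commute (j , one) (k , single a) = ≈-sym (yx-commute-y k a j)
  basisWord-commute (j , single a) (k , one) = yx-commute-y j a k
  basisWord-commute (j , single a) (k , single b) = yx-commute-yx j a k b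
  basisWord-commute t (k , pair i) = ≈-sym (yxx-central k (pair₁ i) (pair₂ i) (basisWord t))
  basisWord-commute (j , pair i) t′ = yxx-central j (pair₁ i) (pair₂ i) (basisWord t′)

  basisWord-IsTranslation : ∀ t → IsTranslation (basisWord t)
  basisWord-IsTranslation (j , one) = y-IsTranslation j
  basisWord-IsTranslation (j , single a) = IsTranslation-comm⁺ [ Y j ] [ X a ]
  basisWord-IsTranslation (j , pair i) = IsTranslation-comm⁺ (yx j (pair₁ i)) [ X (pair₂ i) ]

  vecPart-basisWord-self : ∀ t → vecPart (basisWord t) (proj₁ t) (proj₂ t) ≡ true
  vecPart-basisWord-self (j , one) = δ-refl j
  vecPart-basisWord-self (j , single a) = trans (vecPart-yx j a j (single a)) (cong₂ _∧_ (δ-refl a) (δ-refl j))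
  vecPart-basisWord-self (j , pair i) = trans (vecPart-yxx j p₁ p₂ j (pair i)) (cong₂ _xor_ p₁p₂-term p₂p₁-term)
    where
    p₁ = pair₁ i
    p₂ = pair₂ i
    p₁p₂-term : δ p₁ p₂ ∧ (δ p₂ p₁ ∧ δ j j) ≡ false
    p₁p₂-term = cong (_∧ (δ p₂ p₁ ∧ δ j j)) (δ-≢ (pair₁≢pair₂ i))
    p₂p₁-term : δ p₂ p₂ ∧ (δ p₁ p₁ ∧ δ j j) ≡ true
    p₂p₁-term = cong₂ _∧_ (δ-refl p₂) (cong₂ _∧_ (δ-refl p₁) (δ-refl j))

  vecPart-basisWord-other : ∀ t t′ → t ≢ t′ → vecPart (basisWord t) (proj₁ t′) (proj₂ t′) ≡ false
  vecPart-basisWord-other (j , one) (j′ , one) t≢t′ = δ-≢ (λ j≡j′ → t≢t′ (cong (_, one) j≡j′))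
  vecPart-basisWord-other (j , one) (j′ , single _) _ = refl
  vecPart-basisWord-other (j , one) (j′ , pair _) _ = refl
  vecPart-basisWord-other (j , single a) (j′ , m) t≢t′ = trans (vecPart-yx j a j′ m) (yx-other m t≢t′)
    where
    yx-other : ∀ m → (j , single a) ≢ (j′ , m) → mulT a (unit j) j′ m ≡ false
    yx-other one _ = refl
    yx-other (single b) t≢t′ =
      δ-∧ (λ b≡a → δ-≢ (λ j≡j′ → t≢t′ (cong₂ _,_ j≡j′ (cong single (sym b≡a)))))
    yx-other (pair i′) _ = cong₂ _xor_ (∧-zeroʳ (δ (pair₁ i′) a)) (∧-zeroʳ (δ (pair₂ i′) a))
  vecPart-basisWord-other (j , pair i) (j′ , m) t≢t′ = trans (vecPart-yxx j p₁ p₂ j′ m) (yxx-other m t≢t′)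
    where
    p₁ = pair₁ i
    p₂ = pair₂ i
    yxx-other : ∀ m → (j , pair i) ≢ (j′ , m) → mulT p₂ (mulT p₁ (unit j)) j′ m ≡ false
    yxx-other one _ = refl
    yxx-other (single c) _ = ∧-zeroʳ (δ c p₂)
    yxx-other (pair i′) t≢t′ = cong₂ _xor_ (δ-∧ (λ p₁′≡p₂ → δ-∧ (λ p₂′≡p₁ → ⊥-elim (order-reversed p₁′≡p₂ p₂′≡p₁))))
                                           (δ-∧ (λ p₂′≡p₂ → δ-∧ (λ p₁′≡p₁ → δ-≢ (λ j≡j′ → t≢t′ (same p₁′≡p₁ p₂′≡p₂ j≡j′)))))
      where
      order-reversed : pair₁ i′ ≡ p₂ → pair₂ i′ ≡ p₁ → ⊥
      order-reversed p₁′≡p₂ p₂′≡p₁ =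
        <-asym (pairAt-< n i) (subst₂ _<_ (cong toℕ p₂′≡p₁) (cong toℕ p₁′≡p₂) (pairAt-< n i′))
      same : pair₁ i′ ≡ p₁ → pair₂ i′ ≡ p₂ → j ≡ j′ → (j , pair i) ≡ (j′ , pair i′)
      same p₁′≡p₁ p₂′≡p₂ j≡j′ = cong₂ _,_ j≡j′ (cong pair (pairAt-injective n i i′ (sym (cong₂ _,_ p₁′≡p₁ p₂′≡p₂))))

  Monomial↔Fin : Monomial ↔ Fin (suc (n + pairs n))
  Monomial↔Fin = mk↔ₛ′ toFin fromFin toFin-fromFin fromFin-toFin
    where
    toFin : Monomial → Fin (suc (n + pairs n))
    toFin one = Fin.zero
    toFin (single a) = Fin.suc (a ↑ˡ pairs n)
    toFin (pair i) = Fin.suc (n ↑ʳ i)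

    fromFin : Fin (suc (n + pairs n)) → Monomial
    fromFin Fin.zero = one
    fromFin (Fin.suc r) = [ single , pair ]′ (splitAt n r)

    toFin-fromFin : ∀ r → toFin (fromFin r) ≡ r
    toFin-fromFin Fin.zero = refl
    toFin-fromFin (Fin.suc r) with splitAt n r in split-r
    ... | inj₁ a = cong Fin.suc (splitAt-injective (trans (splitAt-↑ˡ n a (pairs n)) (sym split-r)))
    ... | inj₂ i = cong Fin.suc (splitAt-injective (trans (splitAt-↑ʳ n (pairs n) i) (sym split-r)))

    fromFin-toFin : ∀ m → fromFin (toFin m) ≡ m
    fromFin-toFin one = refl
    fromFin-toFin (single a) rewrite splitAt-↑ˡ n a (pairs n) = refl
    fromFin-toFin (pair i) rewrite splitAt-↑ʳ n (pairs n) i = refl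

  Basis↔Fin : Basis ↔ Fin (n * suc (n + pairs n))
  Basis↔Fin = ↔-trans (↔-refl ×-↔ Monomial↔Fin) (↔-sym Finₚ.*↔×)

  open Inverse Basis↔Fin public using () renaming (to to basisIndex; from to basisAt;
    strictlyInverseˡ to basisIndex-basisAt; strictlyInverseʳ to basisAt-basisIndex)

  vecPart-basisWord : ∀ t t′ → vecPart (basisWord t) (proj₁ t′) (proj₂ t′) ≡ δ (basisIndex t) (basisIndex t′)
  vecPart-basisWord t t′ with basisIndex t Finₚ.≟ basisIndex t′
  ... | yes same = subst (λ s → vecPart (basisWord t) (proj₁ s) (proj₂ s) ≡ true) t≡t′ (vecPart-basisWord-self t)
    where t≡t′ = trans (sym (basisAt-basisIndex t)) (trans (cong basisAt same) (basisAt-basisIndex t′))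
  ... | no differ = vecPart-basisWord-other t t′ (λ t≡t′ → differ (cong basisIndex t≡t′))

  ∏ : ∀ {L} → (Fin L → List (XY n)) → (Fin L → Bool) → List (XY n)
  ∏ {zero} W g = []
  ∏ {suc L} W g = (if g Fin.zero then W Fin.zero else []) ++ ∏ (W ∘ Fin.suc) (g ∘ Fin.suc)

  ∏-cong : ∀ {L} (W : Fin L → List (XY n)) {g g′ : Fin L → Bool} →
           (∀ i → g i ≡ g′ i) → ∏ W g ≡ ∏ W g′
  ∏-cong {zero} W g≡g′ = refl
  ∏-cong {suc L} W g≡g′ =
    cong₂ (λ b w → (if b then W Fin.zero else []) ++ w) (g≡g′ Fin.zero)
          (∏-cong (W ∘ Fin.suc) (g≡g′ ∘ Fin.suc))

  ∏-false : ∀ {L} (W : Fin L → List (XY n)) → ∏ W (λ _ → false) ≡ []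
  ∏-false {zero} W = refl
  ∏-false {suc L} W = ∏-false (W ∘ Fin.suc)

  ∏-toggle : ∀ {L} (W : Fin L → List (XY n)) g i₀ → (∀ i → Commute (W i₀) (W i)) → W i₀ ++ W i₀ ≈ [] →
             W i₀ ++ ∏ W g ≈ ∏ W (λ i → g i xor δ i i₀)
  ∏-toggle {suc L} W g Fin.zero commute square with g Fin.zero
  ... | true = ≈-trans (≡⇒≈ (sym (++-assoc (W Fin.zero) (W Fin.zero) _)))
                 (≈-trans (≈-++ʳ _ square) (≡⇒≈ (∏-cong (W ∘ Fin.suc) (λ i → sym (xor-identityʳ _)))))
  ... | false = ≈-++ˡ (W Fin.zero) (≡⇒≈ (∏-cong (W ∘ Fin.suc) (λ i → sym (xor-identityʳ _))))
  ∏-toggle {suc L} W g (Fin.suc i₀) commute square with g Fin.zero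
  ... | false = ∏-toggle (W ∘ Fin.suc) (g ∘ Fin.suc) i₀ (commute ∘ Fin.suc) square
  ... | true = begin
    W (Fin.suc i₀) ++ W Fin.zero ++ rest
      ≡⟨ ++-assoc (W (Fin.suc i₀)) (W Fin.zero) rest ⟨
    (W (Fin.suc i₀) ++ W Fin.zero) ++ rest
      ≈⟨ ≈-++ʳ rest (commute Fin.zero) ⟩
    (W Fin.zero ++ W (Fin.suc i₀)) ++ rest
      ≡⟨ ++-assoc (W Fin.zero) (W (Fin.suc i₀)) rest ⟩
    W Fin.zero ++ W (Fin.suc i₀) ++ rest
      ≈⟨ ≈-++ˡ (W Fin.zero) (∏-toggle (W ∘ Fin.suc) (g ∘ Fin.suc) i₀ (commute ∘ Fin.suc) square) ⟩
    W Fin.zero ++ ∏ (W ∘ Fin.suc) (λ i → g (Fin.suc i) xor δ i i₀) ∎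
    where
    open ≈-Reasoning
    rest = ∏ (W ∘ Fin.suc) (g ∘ Fin.suc)

  IsTranslation-∏ : ∀ {L} (W : Fin L → List (XY n)) g → (∀ i → IsTranslation (W i)) → IsTranslation (∏ W g)
  IsTranslation-∏ {zero} W g tW = (λ v → ≋-refl) , (λ k → refl)
  IsTranslation-∏ {suc L} W g tW with g Fin.zero
  ... | true = IsTranslation-++ (W Fin.zero) (∏ W′ g′) (tW Fin.zero) (IsTranslation-∏ W′ g′ (tW ∘ Fin.suc))
    where
    W′ = W ∘ Fin.suc
    g′ = g ∘ Fin.suc
  ... | false = IsTranslation-∏ (W ∘ Fin.suc) (g ∘ Fin.suc) (tW ∘ Fin.suc)

  vecPart-∏ : ∀ {L} (W : Fin L → List (XY n)) g → (∀ i → IsTranslation (W i)) →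
              ∀ j m → vecPart (∏ W g) j m ≡ ⨁ (λ i → g i ∧ vecPart (W i) j m)
  vecPart-∏ {zero} W g tW j m = refl
  vecPart-∏ {suc L} W g tW j m with g Fin.zero
  ... | true = begin
    vecPart (W Fin.zero ++ ∏ W′ g′) j m
      ≡⟨ vecPart-translation-++ (W Fin.zero) (∏ W′ g′) (proj₁ (tW Fin.zero)) j m ⟩
    vecPart (∏ W′ g′) j m xor vecPart (W Fin.zero) j m
      ≡⟨ xor-comm (vecPart (∏ W′ g′) j m) (vecPart (W Fin.zero) j m) ⟩
    vecPart (W Fin.zero) j m xor vecPart (∏ W′ g′) j m
      ≡⟨ cong (vecPart (W Fin.zero) j m xor_) (vecPart-∏ W′ g′ (tW ∘ Fin.suc) j m) ⟩
    vecPart (W Fin.zero) j m xor ⨁ (λ i → g′ i ∧ vecPart (W′ i) j m) ∎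
    where
    open ≡-Reasoning
    W′ = W ∘ Fin.suc
    g′ = g ∘ Fin.suc
  ... | false = vecPart-∏ (W ∘ Fin.suc) (g ∘ Fin.suc) (tW ∘ Fin.suc) j m

  vecPart-∏-x : ∀ {L} (f : Fin L → Fin n) s → vecPart (∏ (λ i → [ X (f i) ]) s) ≋ 0V
  vecPart-∏-x {zero} f s = ≋-refl
  vecPart-∏-x {suc L} f s with s Fin.zero
  ... | true = ≋-trans (act-cong (f Fin.zero) (vecPart-∏-x (f ∘ Fin.suc) (s ∘ Fin.suc))) (act-0 (f Fin.zero))
  ... | false = vecPart-∏-x (f ∘ Fin.suc) (s ∘ Fin.suc)

  parity-∏-x : ∀ {L} (f : Fin L → Fin n) s k →
               parity (∏ (λ i → [ X (f i) ]) s) k ≡ ⨁ (λ i → s i ∧ δ (f i) k)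
  parity-∏-x {zero} f s k = refl
  parity-∏-x {suc L} f s k with s Fin.zero
  ... | true = trans (cong (_xor δ (f Fin.zero) k) (parity-∏-x f′ s′ k))
                     (xor-comm (⨁ (λ i → s′ i ∧ δ (f′ i) k)) (δ (f Fin.zero) k))
    where
    f′ = f ∘ Fin.suc
    s′ = s ∘ Fin.suc
  ... | false = parity-∏-x (f ∘ Fin.suc) (s ∘ Fin.suc) k

  Coords : Set
  Coords = V × (Fin n → Bool)

  nfV : V → List (XY n)
  nfV v = ∏ (basisWord ∘ basisAt) (uncurry v ∘ basisAt)

  nfX : (Fin n → Bool) → List (XY n)
  nfX s = ∏ (λ k → [ X k ]) s

  nf : Coords → List (XY n)
  nf (v , s) = nfV v ++ nfX s

  nfV-cong : ∀ {v v′} → v ≋ v′ → nfV v ≡ nfV v′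
  nfV-cong v≋v′ = ∏-cong (basisWord ∘ basisAt) (λ i → v≋v′ (proj₁ (basisAt i)) (proj₂ (basisAt i)))

  nf-cong : ∀ {v v′ s s′} → v ≋ v′ → (∀ k → s k ≡ s′ k) → nf (v , s) ≡ nf (v′ , s′)
  nf-cong v≋v′ s≡s′ = cong₂ _++_ (nfV-cong v≋v′) (∏-cong (λ k → [ X k ]) s≡s′)

  nf-zero : nf (0V , λ _ → false) ≡ []
  nf-zero = cong₂ _++_ (∏-false (basisWord ∘ basisAt)) (∏-false (λ k → [ X k ]))

  IsTranslation-nfV : ∀ v → IsTranslation (nfV v)
  IsTranslation-nfV v = IsTranslation-∏ (basisWord ∘ basisAt) _ (basisWord-IsTranslation ∘ basisAt)

  vecPart-nfV : ∀ v → vecPart (nfV v) ≋ v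
  vecPart-nfV v j m = begin
    vecPart (nfV v) j m
      ≡⟨ vecPart-∏ (basisWord ∘ basisAt) (uncurry v ∘ basisAt) (basisWord-IsTranslation ∘ basisAt) j m ⟩
    ⨁ (λ i → uncurry v (basisAt i) ∧ vecPart (basisWord (basisAt i)) j m)
      ≡⟨ ⨁-cong (λ i → cong (uncurry v (basisAt i) ∧_) (vecPart-basisWordAt i)) ⟩
    ⨁ (λ i → uncurry v (basisAt i) ∧ δ i (basisIndex (j , m)))
      ≡⟨ ⨁-δ (uncurry v ∘ basisAt) (basisIndex (j , m)) ⟩
    uncurry v (basisAt (basisIndex (j , m)))
      ≡⟨ cong (uncurry v) (basisAt-basisIndex (j , m)) ⟩
    v j m ∎
    where
    open ≡-Reasoning
    vecPart-basisWordAt : ∀ i → vecPart (basisWord (basisAt i)) j m ≡ δ i (basisIndex (j , m))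
    vecPart-basisWordAt i =
      trans (vecPart-basisWord (basisAt i) (j , m)) (cong (λ r → δ r (basisIndex (j , m))) (basisIndex-basisAt i))

  vecPart-nf : ∀ v s → vecPart (nf (v , s)) ≋ v
  vecPart-nf v s = begin
    vecPart (nfV v ++ nfX s)          ≈⟨ vecPart-translation-++ (nfV v) (nfX s) (proj₁ (IsTranslation-nfV v)) ⟩
    vecPart (nfX s) ⊕ vecPart (nfV v) ≈⟨ ⊕-cong (vecPart-∏-x (λ k → k) s) (vecPart-nfV v) ⟩
    0V ⊕ v                            ≈⟨ (λ j m → refl) ⟩
    v                                 ∎
    where open ≋-Reasoning

  parity-nf : ∀ v s k → parity (nf (v , s)) k ≡ s k
  parity-nf v s k = begin
    parity (nfV v ++ nfX s) k
      ≡⟨ parity-++ (nfV v) (nfX s) k ⟩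
    parity (nfX s) k xor parity (nfV v) k
      ≡⟨ cong₂ _xor_ (parity-∏-x (λ k → k) s k) (proj₂ (IsTranslation-nfV v) k) ⟩
    ⨁ (λ i → s i ∧ δ i k) xor false
      ≡⟨ xor-identityʳ _ ⟩
    ⨁ (λ i → s i ∧ δ i k)
      ≡⟨ ⨁-δ s k ⟩
    s k ∎
    where open ≡-Reasoning

  basisWord-nfV : ∀ t v → basisWord t ++ nfV v ≈ nfV (v ⊕ vecPart (basisWord t))
  basisWord-nfV t v = begin
    basisWord t ++ nfV v
      ≡⟨ cong (λ s → basisWord s ++ nfV v) (basisAt-basisIndex t) ⟨
    W t₀ ++ ∏ W g
      ≈⟨ ∏-toggle W g t₀ (λ i → basisWord-commute (basisAt t₀) (basisAt i)) (basisWord-square (basisAt t₀)) ⟩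
    ∏ W (λ i → g i xor δ i t₀)
      ≡⟨ ∏-cong W (λ i → cong (g i xor_) (toggled i)) ⟩
    nfV (v ⊕ vecPart (basisWord t)) ∎
    where
    open ≈-Reasoning
    W = basisWord ∘ basisAt
    g = uncurry v ∘ basisAt
    t₀ = basisIndex t
    toggled : ∀ i → δ i t₀ ≡ uncurry (vecPart (basisWord t)) (basisAt i)
    toggled i = sym (trans (vecPart-basisWord t (basisAt i)) (trans (cong (δ t₀) (basisIndex-basisAt i)) (δ-sym t₀ i)))

  basisProduct : List Basis → List (XY n)
  basisProduct [] = []
  basisProduct (t ∷ ts) = basisWord t ++ basisProduct ts

  basisProduct-++ : ∀ ts us → basisProduct (ts ++ us) ≡ basisProduct ts ++ basisProduct us
  basisProduct-++ [] us = refl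
  basisProduct-++ (t ∷ ts) us = trans (cong (basisWord t ++_) (basisProduct-++ ts us)) (sym (++-assoc (basisWord t) _ _))

  IsTranslation-basisProduct : ∀ ts → IsTranslation (basisProduct ts)
  IsTranslation-basisProduct [] = (λ v → ≋-refl) , (λ k → refl)
  IsTranslation-basisProduct (t ∷ ts) =
    IsTranslation-++ (basisWord t) (basisProduct ts) (basisWord-IsTranslation t) (IsTranslation-basisProduct ts)

  basisProduct-nfV : ∀ ts v → basisProduct ts ++ nfV v ≈ nfV (v ⊕ vecPart (basisProduct ts))
  basisProduct-nfV [] v = ≡⇒≈ (nfV-cong (λ j m → sym (xor-identityʳ (v j m))))
  basisProduct-nfV (t ∷ ts) v = begin
    (basisWord t ++ basisProduct ts) ++ nfV v
      ≡⟨ ++-assoc (basisWord t) (basisProduct ts) (nfV v) ⟩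
    basisWord t ++ basisProduct ts ++ nfV v
      ≈⟨ ≈-++ˡ (basisWord t) (basisProduct-nfV ts v) ⟩
    basisWord t ++ nfV (v ⊕ vecPart (basisProduct ts))
      ≈⟨ basisWord-nfV t (v ⊕ vecPart (basisProduct ts)) ⟩
    nfV (v ⊕ vecPart (basisProduct ts) ⊕ vecPart (basisWord t))
      ≡⟨ nfV-cong reassociate ⟩
    nfV (v ⊕ vecPart (basisProduct (t ∷ ts))) ∎
    where
    open ≈-Reasoning
    reassociate : v ⊕ vecPart (basisProduct ts) ⊕ vecPart (basisWord t) ≋ v ⊕ vecPart (basisProduct (t ∷ ts))
    reassociate j m = trans (xor-assoc (v j m) _ _)
      (cong (v j m xor_) (sym (vecPart-translation-++ (basisWord t) (basisProduct ts)
                                                         (proj₁ (basisWord-IsTranslation t)) j m)))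

  conjugate-x-∏ : ∀ k {L} (W : Fin L → List (XY n)) g →
                  (∀ i → ∃ λ ts → X k ∷ W i ++ [ X k ] ≈ basisProduct ts) →
                  ∃ λ ts → X k ∷ ∏ W g ++ [ X k ] ≈ basisProduct ts
  conjugate-x-∏ k {zero} W g conj-W = [] , square≈[] (X k)
  conjugate-x-∏ k {suc L} W g conj-W with g Fin.zero
  ... | false = conjugate-x-∏ k (W ∘ Fin.suc) (g ∘ Fin.suc) (conj-W ∘ Fin.suc)
  ... | true with conj-W Fin.zero | conjugate-x-∏ k (W ∘ Fin.suc) (g ∘ Fin.suc) (conj-W ∘ Fin.suc)
  ...   | ts , conj-W₀ | us , conj-rest =
    ts ++ us ,
    ≈-trans (conjugate-++ (X k) (W Fin.zero) _)
            (≈-trans (≈-++ conj-W₀ conj-rest) (≡⇒≈ (sym (basisProduct-++ ts us))))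

  conjugate-x-basisWord : ∀ k t → ∃ λ ts → X k ∷ basisWord t ++ [ X k ] ≈ basisProduct ts
  conjugate-x-basisWord k (j , one) = (j , one) ∷ (j , single k) ∷ [] , conjugate-x-y k j
  conjugate-x-basisWord k (j , single a) with <-cmp k a
  ... | tri≈ _ k≡a _ = (j , single a) ∷ [] ,
    ≈-trans (conjugate-x-yx k j a) (≈-++ˡ (yx j a) (subst (λ b → yxx j a b ≈ []) (sym k≡a) (yxx-diagonal j a)))
  ... | tri< k<a _ _ = (j , single a) ∷ (j , pair (pairIndex n a k k<a)) ∷ [] ,
    ≈-trans (conjugate-x-yx k j a)
      (≡⇒≈ (cong (λ p → yx j a ++ yxx j (proj₁ p) (proj₂ p)) (sym (pairAt-pairIndex n a k k<a))))
  ... | tri> _ _ a<k = (j , single a) ∷ (j , pair (pairIndex n k a a<k)) ∷ [] ,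
    ≈-trans (conjugate-x-yx k j a)
      (≈-++ˡ (yx j a) (≈-trans (yxx-sym j a k)
        (≡⇒≈ (cong (λ p → yxx j (proj₁ p) (proj₂ p)) (sym (pairAt-pairIndex n k a a<k))))))
  conjugate-x-basisWord k (j , pair i) = (j , pair i) ∷ [] , conjugate-x-yxx k j (pair₁ i) (pair₂ i)

  x-nf : ∀ k v s → ∃ λ c → X k ∷ nf (v , s) ≈ nf c
  x-nf k v s with conjugate-x-∏ k (basisWord ∘ basisAt) (uncurry v ∘ basisAt)
                    (conjugate-x-basisWord k ∘ basisAt)
  ... | ts , conj-nfV = (vecPart (basisProduct ts) , s′) , (begin
    X k ∷ nfV v ++ nfX s
      ≈⟨ ≈-++ˡ (X k ∷ nfV v) (cancel-square (X k) (nfX s)) ⟨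
    X k ∷ nfV v ++ X k ∷ X k ∷ nfX s
      ≡⟨ cong (X k ∷_) (++-assoc (nfV v) [ X k ] (X k ∷ nfX s)) ⟨
    (X k ∷ nfV v ++ [ X k ]) ++ X k ∷ nfX s
      ≈⟨ ≈-++ conj-nfV (∏-toggle (λ i → [ X i ]) s k (λ i → x-commute k i) (square≈[] (X k))) ⟩
    basisProduct ts ++ nfX s′
      ≡⟨ cong (_++ nfX s′) (++-identityʳ (basisProduct ts)) ⟨
    (basisProduct ts ++ []) ++ nfX s′
      ≡⟨ cong (λ w → (basisProduct ts ++ w) ++ nfX s′) nfV-0V ⟨
    (basisProduct ts ++ nfV 0V) ++ nfX s′
      ≈⟨ ≈-++ʳ (nfX s′) (basisProduct-nfV ts 0V) ⟩
    nfV (0V ⊕ vecPart (basisProduct ts)) ++ nfX s′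
      ≡⟨ cong (_++ nfX s′) (nfV-cong {0V ⊕ vecPart (basisProduct ts)} (λ j m → refl)) ⟩
    nfV (vecPart (basisProduct ts)) ++ nfX s′ ∎)
    where
    open ≈-Reasoning
    s′ = λ i → s i xor δ i k
    nfV-0V : nfV 0V ≡ []
    nfV-0V = ∏-false (basisWord ∘ basisAt)

  y-nf : ∀ j v s → Y j ∷ nf (v , s) ≈ nf (v ⊕ vecPart [ Y j ] , s)
  y-nf j v s = ≈-++ʳ (nfX s) (basisWord-nfV (j , one) v)

  collect : ∀ w → ∃ λ c → w ≈ nf c
  collect [] = (0V , λ _ → false) , ≡⇒≈ (sym nf-zero)
  collect (inj₁ k ∷ w) with collect w
  ... | (v , s) , w≈nf with x-nf k v s
  ...   | c , x-nf≈ = c , ≈-trans (≈-++ˡ [ X k ] w≈nf) x-nf≈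
  collect (inj₂ j ∷ w) with collect w
  ... | (v , s) , w≈nf = (v ⊕ vecPart [ Y j ] , s) , ≈-trans (≈-++ˡ [ Y j ] w≈nf) (y-nf j v s)

  normalise : ∀ w → w ≈ nf (vecPart w , parity w)
  normalise w with collect w
  ... | (v , s) , w≈nf with ≈⇒SameImage w≈nf
  ...   | _ , vec , par = ≈-trans w≈nf (≡⇒≈ (nf-cong v≋ s≡))
    where
    v≋ : v ≋ vecPart w
    v≋ j m = trans (sym (vecPart-nf v s j m)) (sym (vec j m))
    s≡ : ∀ k → s k ≡ parity w k
    s≡ k = trans (sym (parity-nf v s k)) (sym (par k))

  Trivial⇒≈[] : ∀ w → Trivial w → w ≈ []
  Trivial⇒≈[] w ((_ , par) , vec) = ≈-trans (normalise w) (≡⇒≈ (trans (nf-cong vec par) nf-zero))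

open Inverse Finₚ.2↔Bool using ()
  renaming (to to toBool; from to fromBool; strictlyInverseˡ to toBool-fromBool; strictlyInverseʳ to fromBool-toBool)

bits : ∀ L → Fin (2 ^ L) → Fin L → Bool
bits (suc L) i Fin.zero = toBool (proj₁ (remQuot {2} (2 ^ L) i))
bits (suc L) i (Fin.suc f) = bits L (proj₂ (remQuot {2} (2 ^ L) i)) f

fromBits : ∀ L → (Fin L → Bool) → Fin (2 ^ L)
fromBits zero b = Fin.zero
fromBits (suc L) b = combine (fromBool (b Fin.zero)) (fromBits L (b ∘ Fin.suc))

bits-fromBits : ∀ L b f → bits L (fromBits L b) f ≡ b f
bits-fromBits (suc L) b Fin.zero =
  trans (cong (λ p → toBool (proj₁ p)) (remQuot-combine {2} {2 ^ L} (fromBool (b Fin.zero)) (fromBits L (b ∘ Fin.suc))))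
        (toBool-fromBool (b Fin.zero))
bits-fromBits (suc L) b (Fin.suc f) =
  trans (cong (λ p → bits L (proj₂ p) f) (remQuot-combine {2} {2 ^ L} (fromBool (b Fin.zero)) (fromBits L (b ∘ Fin.suc))))
        (bits-fromBits L (b ∘ Fin.suc) f)

bits-injective : ∀ L i j → (∀ f → bits L i f ≡ bits L j f) → i ≡ j
bits-injective zero Fin.zero Fin.zero _ = refl
bits-injective (suc L) i j same-bits = begin
  i                                        ≡⟨ combine-remQuot {2} (2 ^ L) i ⟨
  uncurry combine (remQuot {2} (2 ^ L) i)  ≡⟨ cong (uncurry combine) (cong₂ _,_ same-head same-tail) ⟩
  uncurry combine (remQuot {2} (2 ^ L) j)  ≡⟨ combine-remQuot {2} (2 ^ L) j ⟩
  j                                        ∎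
  where
  open ≡-Reasoning
  same-head = trans (sym (fromBool-toBool _)) (trans (cong fromBool (same-bits Fin.zero)) (fromBool-toBool _))
  same-tail = bits-injective L (proj₂ (remQuot {2} (2 ^ L) i)) (proj₂ (remQuot {2} (2 ^ L) j)) (same-bits ∘ Fin.suc)

module Order (n : ℕ) where

  open NormalForms n

  Index : Set
  Index = Fin n ⊎ Basis

  dimension : ℕ
  dimension = n + n * suc (n + pairs n)

  Index↔Fin : Index ↔ Fin dimension
  Index↔Fin = ↔-trans (↔-refl ⊎-↔ Basis↔Fin) (↔-sym Finₚ.+↔⊎)

  open Inverse Index↔Fin using () renaming (to to index; from to indexAt;
    strictlyInverseˡ to index-indexAt; strictlyInverseʳ to indexAt-index)

  flatten : Coords → Index → Bool
  flatten (v , s) = [ s , uncurry v ]′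

  unflatten : (Index → Bool) → Coords
  unflatten b = (λ j m → b (inj₂ (j , m))) , (λ k → b (inj₁ k))

  coords : Fin (2 ^ dimension) → Coords
  coords i = unflatten (λ x → bits dimension i (index x))

  encode : Coords → Fin (2 ^ dimension)
  encode c = fromBits dimension (λ f → flatten c (indexAt f))

  coords-encode : ∀ c x → flatten (coords (encode c)) x ≡ flatten c x
  coords-encode c (inj₁ k) = trans (bits-fromBits dimension _ (index (inj₁ k))) (cong (flatten c) (indexAt-index (inj₁ k)))
  coords-encode c (inj₂ t) = trans (bits-fromBits dimension _ (index (inj₂ t))) (cong (flatten c) (indexAt-index (inj₂ t)))

  element : Fin (2 ^ dimension) → Word (XY n)
  element i = positive (nf (coords i))

  element-injective : ∀ i i′ → Eqv (HRel n) (element i) (element i′) → i ≡ i′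
  element-injective i i′ eq = bits-injective dimension i i′ λ f →
    subst (λ g → bits dimension i g ≡ bits dimension i′ g) (index-indexAt f) (same-bit (indexAt f))
    where
    same-image : SameImage (nf (coords i)) (nf (coords i′))
    same-image = ≈⇒SameImage (subst₂ _≈_ (letters-positive _) (letters-positive _) (letters-sound eq))
    same-bit : ∀ x → bits dimension i (index x) ≡ bits dimension i′ (index x)
    same-bit (inj₁ k) = begin
      proj₂ (coords i) k                 ≡⟨ parity-nf (proj₁ (coords i)) (proj₂ (coords i)) k ⟨
      parity (nf (coords i)) k           ≡⟨ proj₂ (proj₂ same-image) k ⟩
      parity (nf (coords i′)) k          ≡⟨ parity-nf (proj₁ (coords i′)) (proj₂ (coords i′)) k ⟩
      proj₂ (coords i′) k                ∎
      where open ≡-Reasoning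
    same-bit (inj₂ (j , m)) = begin
      proj₁ (coords i) j m               ≡⟨ vecPart-nf (proj₁ (coords i)) (proj₂ (coords i)) j m ⟨
      vecPart (nf (coords i)) j m        ≡⟨ proj₁ (proj₂ same-image) j m ⟩
      vecPart (nf (coords i′)) j m       ≡⟨ vecPart-nf (proj₁ (coords i′)) (proj₂ (coords i′)) j m ⟩
      proj₁ (coords i′) j m              ∎
      where open ≡-Reasoning

  element-surjective : ∀ w → ∃ λ i → Eqv (HRel n) w (element i)
  element-surjective w = encode c , (begin
    w                         ≈⟨ positive-letters w ⟨
    positive (letters w)      ≈⟨ positive-sound (normalise (letters w)) ⟩
    positive (nf c)           ≡⟨ cong positive (nf-cong (λ j m → sym (coords-encode c (inj₂ (j , m))))
                                                       (λ k → sym (coords-encode c (inj₁ k)))) ⟩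
    element (encode c)        ∎)
    where
    c = vecPart (letters w) , parity (letters w)
    open SetoidReasoning (Eqv-setoid (HRel n))

  hasOrder : HasOrder (HRel n) (2 ^ dimension)
  hasOrder = element , element-injective , element-surjective

module Isomorphism (n : ℕ) where

  open NormalForms n

  image : {G : Set} → (G → XY n) → Word G → List (XY n)
  image f w = map f (letters w)

  module _ {G : Set} (f : G → XY n) where

    image-comm : ∀ u v → image f (comm u v) ≡ comm⁺ (image f u) (image f v)
    image-comm u v = trans (cong (map f) (letters-comm u v)) (map-comm⁺ f (letters u) (letters v))

    image-++ : ∀ u v → image f (u ++ v) ≡ image f u ++ image f v
    image-++ u v = trans (cong (map f) (map-++ proj₁ u v)) (map-++ f (letters u) (letters v))

    image-invW : ∀ u → image f (invW u) ≡ reverse (image f u)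
    image-invW u = trans (cong (map f) (letters-invW u)) (reverse-map f (letters u))

    LCS⇒Γ : ∀ {k w} → LCS (suc (suc k)) w → Γ (suc k) (image f w)
    LCS⇒Γ (lcs-comm {zero} {u} _ v) = subst (Γ 1) (sym (image-comm u v)) (Γ₁-comm⁺ (image f u) (image f v))
    LCS⇒Γ (lcs-comm {suc k} {u} w∈LCS v) =
      subst (Γ (suc (suc k))) (sym (image-comm u v)) (Γ-comm⁺ (suc k) (image f u) (image f v) (LCS⇒Γ w∈LCS))
    LCS⇒Γ {k} lcs-one = Γ-[] (suc k)
    LCS⇒Γ {k} (lcs-mul {u = u} {v} u∈LCS v∈LCS) =
      subst (Γ (suc k)) (sym (image-++ u v)) (Γ-++ (suc k) (image f u) (image f v) (LCS⇒Γ u∈LCS) (LCS⇒Γ v∈LCS))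
    LCS⇒Γ {k} (lcs-inv {u = u} u∈LCS) =
      subst (Γ (suc k)) (sym (image-invW u)) (Γ-reverse (suc k) (image f u) (LCS⇒Γ u∈LCS))

  xyx-Trivial : ∀ a j → Trivial (comm⁺ (comm⁺ [ X a ] [ Y j ]) [ X a ])
  xyx-Trivial a j =
    IsTranslation-comm⁺ xy [ X a ] ,
    (begin
      vecPart (comm⁺ xy [ X a ])
        ≈⟨ vecPart-comm⁺-x xy a (LinearlyTrivial-comm⁺ [ X a ] [ Y j ]) ⟩
      mulT a (vecPart xy)
        ≈⟨ mulT-cong a (vecPart-translation-reverse (yx j a) (LinearlyTrivial-comm⁺ [ Y j ] [ X a ])) ⟩
      mulT a (vecPart (yx j a))
        ≈⟨ mulT-cong a (vecPart-yx j a) ⟩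
      mulT a (mulT a (unit j))
        ≈⟨ mulT-mulT a (unit j) ⟩
      0V ∎)
    where
    open ≋-Reasoning
    xy = comm⁺ [ X a ] [ Y j ]

  zzz-Trivial : ∀ z z′ → Trivial (comm⁺ (comm⁺ [ z ] [ z′ ]) [ z ])
  zzz-Trivial (inj₂ j) z′ =
    Trivial-comm⁺-LinearlyTrivial (comm⁺ [ Y j ] [ z′ ]) [ Y j ] (IsTranslation-comm⁺ [ Y j ] [ z′ ])
      (λ v → ≋-refl)
  zzz-Trivial (inj₁ a) (inj₁ b) = Trivial-comm⁺ (comm⁺ [ X a ] [ X b ]) [ X a ] (relator-Trivial (h-xx a b))
  zzz-Trivial (inj₁ a) (inj₂ j) = xyx-Trivial a j

  ψ : Fin (n + n) → XY n
  ψ = ψgen n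

  ψ-a : ∀ i → image ψ (a n i) ≡ [ X i ]
  ψ-a i = cong [_] (splitAt-↑ˡ n i n)

  ψ-b : ∀ i → image ψ (b n i) ≡ [ Y i ]
  ψ-b i = cong [_] (splitAt-↑ʳ n n i)

  ψ-comm : ∀ u v {u′ v′} → image ψ u ≡ u′ → image ψ v ≡ v′ → image ψ (comm u v) ≡ comm⁺ u′ v′
  ψ-comm u v refl refl = image-comm ψ u v

  ψ-image-Trivial : ∀ {r} → IRel n r → Trivial (image ψ r)
  ψ-image-Trivial (i-K (k-F4 {w} w∈F₄)) = Γ₃⇒Trivial (image ψ w) (LCS⇒Γ ψ w∈F₄)
  ψ-image-Trivial (i-K (k-sq i)) = relator-Trivial (h-sq (ψ i))
  ψ-image-Trivial (i-K (k-c² i j)) = Trivial-square (comm⁺ [ ψ i ] [ ψ j ]) (IsTranslation-comm⁺ [ ψ i ] [ ψ j ])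
  ψ-image-Trivial (i-K (k-cc² i j k)) =
    Trivial-square (comm⁺ (comm⁺ [ ψ i ] [ ψ j ]) [ ψ k ]) (IsTranslation-comm⁺ (comm⁺ [ ψ i ] [ ψ j ]) [ ψ k ])
  ψ-image-Trivial (i-K (k-cci i j)) = zzz-Trivial (ψ i) (ψ j)
  ψ-image-Trivial (i-aa i j) = subst Trivial (sym (ψ-comm (a n i) (a n j) (ψ-a i) (ψ-a j))) (relator-Trivial (h-xx i j))
  ψ-image-Trivial (i-bb i j) = subst Trivial (sym (ψ-comm (b n i) (b n j) (ψ-b i) (ψ-b j))) (relator-Trivial (h-yy i j))
  ψ-image-Trivial (i-aac i j c) =
    subst Trivial (sym (ψ-comm (comm (a n i) (a n j)) (gen c) (ψ-comm (a n i) (a n j) (ψ-a i) (ψ-a j)) refl))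
      (Trivial-comm⁺ (comm⁺ [ X i ] [ X j ]) [ ψ c ] (relator-Trivial (h-xx i j)))
  ψ-image-Trivial (i-bbc i j c) =
    subst Trivial (sym (ψ-comm (comm (b n i) (b n j)) (gen c) (ψ-comm (b n i) (b n j) (ψ-b i) (ψ-b j)) refl))
      (Trivial-comm⁺ (comm⁺ [ Y i ] [ Y j ]) [ ψ c ] (relator-Trivial (h-yy i j)))
  ψ-image-Trivial (i-bab i j k) =
    subst Trivial (sym (ψ-comm (comm (b n i) (a n j)) (b n k) (ψ-comm (b n i) (a n j) (ψ-b i) (ψ-a j)) (ψ-b k)))
      (relator-Trivial (h-yxy i j k))

  ψ-relator : ∀ r → IRel n r → Eqv (HRel n) (mapW ψ r) []
  ψ-relator r r∈I = eqv-trans (eqv-sym (positive-letters (mapW ψ r)))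
    (subst (λ w → Eqv (HRel n) (positive w) []) (sym (letters-mapW ψ r))
      (positive-sound (Trivial⇒≈[] (image ψ r) (ψ-image-Trivial r∈I))))

  φ-relator : ∀ r → HRel n r → Eqv (IRel n) (mapW (φgen n) r) []
  φ-relator _ (h-sq z) = Eqv-relator (i-K (k-sq (φgen n z)))
  φ-relator _ (h-xx i j) = Eqv-relator (i-aa i j)
  φ-relator _ (h-yy i j) = Eqv-relator (i-bb i j)
  φ-relator _ (h-xy² i j) = Eqv-relator (i-K (k-c² (i ↑ˡ n) (n ↑ʳ j)))
  φ-relator _ (h-yxy i j k) = Eqv-relator (i-bab i j k)
  φ-relator _ (h-xyz² i j z) = Eqv-relator (i-K (k-cc² (i ↑ˡ n) (n ↑ʳ j) (φgen n z)))
  φ-relator _ (h-zzzz z z′ z″ z‴) =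
    Eqv-relator (i-K (k-F4 (lcs-comm (lcs-comm (lcs-comm (lcs-all (gen (φ z))) (gen (φ z′))) (gen (φ z″)))
                                     (gen (φ z‴)))))
    where φ = φgen n

exponent : ∀ n → (n * n * n + n * n + 4 * n) / 2 ≡ n + n * suc (n + pairs n)
exponent n = trans (cong (_/ 2) doubled) (m*n/n≡m (n + n * suc (n + pairs n)) 2)
  where
  open ≡-Reasoning
  open +-*-Solver
  doubled : n * n * n + n * n + 4 * n ≡ (n + n * suc (n + pairs n)) * 2
  doubled = begin
    n * n * n + n * n + 4 * n
      ≡⟨ cong (λ t → t + n * n + 4 * n) (*-assoc n n n) ⟩
    n * (n * n) + n * n + 4 * n
      ≡⟨ cong (λ t → n * t + n * n + 4 * n) (twice-pairs n) ⟨
    n * (2 * pairs n + n) + n * n + 4 * n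
      ≡⟨ solve 2 (λ n p → n :* (con 2 :* p :+ n) :+ n :* n :+ con 4 :* n := (n :+ n :* (con 1 :+ (n :+ p))) :* con 2)
                 refl n (pairs n) ⟩
    (n + n * suc (n + pairs n)) * 2 ∎

proposition4p3 : (n : ℕ) → 2 ≤ n →
    RespectsRel (HRel n) (IRel n) (φgen n)
    × RespectsRel (IRel n) (HRel n) (ψgen n)
    × (∀ w → Eqv (HRel n) (mapW (ψgen n) (mapW (φgen n) w)) w)
    × (∀ w → Eqv (IRel n) (mapW (φgen n) (mapW (ψgen n) w)) w)
    × HasOrder (HRel n) (2 ^ ((n * n * n + n * n + 4 * n) / 2))
proposition4p3 n _ =
  respectsRel-fromRelators (φgen n) (Isomorphism.φ-relator n) ,
  respectsRel-fromRelators (ψgen n) (Isomorphism.ψ-relator n) ,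
  (λ w → ≡⇒Eqv (mapW-inverse (splitAt-join n n) w)) ,
  (λ w → ≡⇒Eqv (mapW-inverse (join-splitAt n n) w)) ,
  subst (λ e → HasOrder (HRel n) (2 ^ e)) (sym (exponent n)) (Order.hasOrder n)
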